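{- Assume the lexicographic order over the $n$ variables $x_1,\dots,x_n$ is loaded, i.e., the order is given by $\mathcal{O}(\vec{d})=\{d_n\ge1\}$ and specification $\mathcal{S}_{\mathrm{lex}}$ below, with order variables $\vec{z}=x_1,\dots,x_n$. Let $\sigma$ be a symmetry of the input formula with support $\{x_{i_1},\dots,x_{i_k}\}$, $i_1<\dots<i_k$, $k=|\mathrm{supp}(\sigma)|$, and let $\mathcal{C}$, $\mathcal{D}$ be the core and derived sets, where $\mathcal{D}$ contains the circuit constraints below. Let $C\doteq t_k\ge1$. Then the proof goal $$\mathcal{C}\cup\mathcal{D}\cup\{\neg C\}\cup\mathcal{S}_{\mathrm{lex}}(\vec{x},\vec{x}\!\upharpoonright_\sigma,\vec{a},\vec{d})\cup\{d_n\ge1\}\vdash\bot$$ can be shown using $O(k)$ RUP steps and cutting planes steps, where the RUP steps require $O(n)$ propagations in total.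
   Context: Literals: $x$ or $\bar x=1-x$; $\bot\doteq0\ge1$; negation $\neg(\sum_i a_i\ell_i\ge A)\doteq\sum_ia_i\bar\ell_i\ge\sum_ia_i-A+1$. $\mathcal{S}_{\mathrm{lex}}(\vec{u},\vec{v},\vec{a},\vec{d})$ over $u_1..u_n$, $v_1..v_n$, auxiliary $a_1..a_{n-1}$, $d_1..d_n$: $\bar a_1+u_1+\bar v_1\ge1$; $2a_1+\bar u_1+v_1\ge2$; for $1\le i\le n-2$: $3\bar a_{i+1}+2a_i+u_{i+1}+\bar v_{i+1}\ge3$, $2a_{i+1}+2\bar a_i+\bar u_{i+1}+v_{i+1}\ge2$; $\bar d_1+v_1+\bar u_1\ge1$; $2d_1+\bar v_1+u_1\ge2$; for $1\le i\le n-1$: $4\bar d_{i+1}+3d_i+\bar a_i+v_{i+1}+\bar u_{i+1}\ge4$, $4d_{i+1}+3\bar d_i+a_i+\bar v_{i+1}+u_{i+1}\ge3$. $\mathcal{S}_{\mathrm{lex}}(\vec{x},\vec{x}\!\upharpoonright_\sigma,\vec{a},\vec{d})$ substitutes $u_i:=x_i$, $v_i:=\sigma(x_i)$. A symmetry $\sigma$ is a permutation of literals with $\sigma(\bar\ell)=\overline{\sigma(\ell)}$, finite support $\mathrm{supp}(\sigma)=\{x:\sigma(x)\ne x\}$, and $\mathcal{C}\!\upharpoonright_\sigma=\mathcal{C}$ syntactically. Circuit constraints (over fresh variables $s_1..s_{k-1}$, $t_1..t_k$, writing $x_j'$ for $x_{i_j}$): $\bar s_1+x_1'+\overline{\sigma(x_1')}\ge1$;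 $2s_1+\bar x_1'+\sigma(x_1')\ge2$; for $1\le j\le k-2$: $3\bar s_{j+1}+2s_j+x_{j+1}'+\overline{\sigma(x_{j+1}')}\ge3$, $2s_{j+1}+2\bar s_j+\bar x_{j+1}'+\sigma(x_{j+1}')\ge2$; $\bar t_1+\sigma(x_1')+\bar x_1'\ge1$; $2t_1+\overline{\sigma(x_1')}+x_1'\ge2$; for $1\le j\le k-1$: $4\bar t_{j+1}+3t_j+\bar s_j+\sigma(x_{j+1}')+\bar x_{j+1}'\ge4$, $3t_{j+1}+3\bar t_j+s_j+\overline{\sigma(x_{j+1}')}+x_{j+1}'\ge3$. RUP step: derive $C$ from premises $F$ if unit propagation on $F\cup\{\neg C\}$ from the empty assignment reaches a conflict (a constraint propagates an unassigned literal to 1 when its coefficient exceeds the slack $\sum_{\rho(\ell_i)\ne0}a_i-A$, and is a conflict when the slack is negative); propagations are counted as literals assigned. Cutting planes steps: addition, positive scaling, saturation, weakening, division with rounding up, literal axioms. -}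

module Defs where

open import Data.Bool using (Bool; true; false; if_then_else_; _∧_; not)
open import Data.Nat as ℕ using (ℕ; zero; suc; _/_; _≡ᵇ_)
open import Data.Integer as ℤ using (ℤ; +_; -[1+_]; _-_; -_)
open import Data.List using (List; []; _∷_; _++_; map; concatMap; upTo; deduplicateᵇ; filter)
open import Data.Nat.ListAction using (sum)
open import Data.List.Membership.Propositional using (_∈_)
open import Data.List.Relation.Binary.Permutation.Propositional using (_↭_)
open import Data.Product using (_×_; _,_; proj₁; proj₂; ∃-syntax; Σ-syntax)
open import Relation.Binary.PropositionalEquality using (_≡_; _≢_)

-- Variables and literals
-- x i : formula (order) variables x_1..x_n (1-based indices)
-- a i, d i : auxiliary variables of the lex specification
-- s j, t j : fresh variables of the circuit constraints

data Var : Set where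
  x a d s t : ℕ → Var

_==V_ : Var → Var → Bool
x m ==V x n = m ≡ᵇ n
a m ==V a n = m ≡ᵇ n
d m ==V d n = m ≡ᵇ n
s m ==V s n = m ≡ᵇ n
t m ==V t n = m ≡ᵇ n
_   ==V _   = false

isST : Var → Bool
isST (s _) = true
isST (t _) = true
isST _     = false

data Lit : Set where
  pos neg : Var → Lit

litVar : Lit → Var
litVar (pos v) = v
litVar (neg v) = v

~_ : Lit → Lit
~ pos v = neg v
~ neg v = pos v

_==L_ : Lit → Lit → Bool
pos u ==L pos v = u ==V v
neg u ==L neg v = u ==V v
_ ==L _ = false

memL : Lit → List Lit → Bool
memL ℓ [] = false
memL ℓ (m ∷ ms) = if ℓ ==L m then true else memL ℓ ms

Term : Set
Term = ℕ × Lit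

record PB : Set where
  constructor _≥ᵖ_
  field
    lhs : List Term
    rhs : ℤ
open PB public

⊥ᵖ : PB
⊥ᵖ = [] ≥ᵖ (+ 1)

¬ᵖ : PB → PB
¬ᵖ (ts ≥ᵖ A) = map (λ u → proj₁ u , ~ proj₂ u) ts ≥ᵖ ((+ sum (map proj₁ ts) - A) ℤ.+ + 1)

_↾_ : PB → (Lit → Lit) → PB
(ts ≥ᵖ A) ↾ σ = map (λ u → proj₁ u , σ (proj₂ u)) ts ≥ᵖ A

-- Normal form: merge terms on the same variable, cancel ℓ + ℓ̄ = 1,
-- drop zero coefficients (literal-normalised form).

coef : List Term → Var → ℤ
coef [] v = + 0
coef ((c , pos u) ∷ ts) v = (if u ==V v then + c else + 0) ℤ.+ coef ts v
coef ((c , neg u) ∷ ts) v = (if u ==V v then - (+ c) else + 0) ℤ.+ coef ts v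

negSum : List Term → ℕ
negSum [] = 0
negSum ((c , pos _) ∷ ts) = negSum ts
negSum ((c , neg _) ∷ ts) = c ℕ.+ negSum ts

litTerm : Var → ℤ → List Term
litTerm v (+ zero) = []
litTerm v (+ suc n) = (suc n , pos v) ∷ []
litTerm v -[1+ n ] = (suc n , neg v) ∷ []

negPart : ℤ → ℕ
negPart (+ _) = 0
negPart -[1+ n ] = suc n

norm : PB → PB
norm (ts ≥ᵖ A) =
  concatMap (λ v → litTerm v (coef ts v)) vs
    ≥ᵖ ((A - + negSum ts) ℤ.+ + sum (map (λ v → negPart (coef ts v)) vs))
  where
  vs : List Var
  vs = deduplicateᵇ _==V_ (map (λ u → litVar (proj₂ u)) ts)

axiomᵖ : Lit → PB
axiomᵖ ℓ = ((1 , ℓ) ∷ []) ≥ᵖ (+ 0)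

addᵖ : PB → PB → PB
addᵖ (ts ≥ᵖ A) (us ≥ᵖ B) = (ts ++ us) ≥ᵖ (A ℤ.+ B)

-- multiplication by the positive integer suc m
scaleᵖ : ℕ → PB → PB
scaleᵖ m (ts ≥ᵖ A) = map (λ u → suc m ℕ.* proj₁ u , proj₂ u) ts ≥ᵖ (+ suc m ℤ.* A)

ceilℕ : ℕ → ℕ → ℕ      -- ⌈ b / (suc m) ⌉
ceilℕ b m = (b ℕ.+ m) / suc m

ceilℤ : ℤ → ℕ → ℤ      -- ⌈ A / (suc m) ⌉
ceilℤ (+ n) m = + ceilℕ n m
ceilℤ -[1+ n ] m = - (+ (suc n / suc m))

divᵖ : ℕ → PB → PB
divᵖ m c with norm c
... | ts ≥ᵖ A = map (λ u → ceilℕ (proj₁ u) m , proj₂ u) ts ≥ᵖ ceilℤ A m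

posPart : ℤ → ℕ
posPart (+ n) = n
posPart -[1+ _ ] = 0

satᵖ : PB → PB
satᵖ c with norm c
... | ts ≥ᵖ A = map (λ u → ℕ._⊓_ (proj₁ u) (posPart A) , proj₂ u) ts ≥ᵖ A

weakenᵖ : Var → PB → PB
weakenᵖ v c with norm c
... | ts ≥ᵖ A =
  filterV ts ≥ᵖ (A - + sum (map proj₁ (onlyV ts)))
  where
  filterV onlyV : List Term → List Term
  filterV [] = []
  filterV (u ∷ us) = if litVar (proj₂ u) ==V v then filterV us else u ∷ filterV us
  onlyV [] = []
  onlyV (u ∷ us) = if litVar (proj₂ u) ==V v then u ∷ onlyV us else onlyV us

data CPStep (Δ : List PB) : PB → Set where
  ax    : (ℓ : Lit) → CPStep Δ (axiomᵖ ℓ)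
  add   : ∀ {c₁ c₂} → c₁ ∈ Δ → c₂ ∈ Δ → CPStep Δ (addᵖ c₁ c₂)
  scale : ∀ {c} (m : ℕ) → c ∈ Δ → CPStep Δ (scaleᵖ m c)
  div   : ∀ {c} (m : ℕ) → c ∈ Δ → CPStep Δ (divᵖ m c)
  sat   : ∀ {c} → c ∈ Δ → CPStep Δ (satᵖ c)
  weak  : ∀ {c} (v : Var) → c ∈ Δ → CPStep Δ (weakenᵖ v c)

-- partial assignment: list of literals assigned 1
Assignment : Set
Assignment = List Lit

slack : Assignment → PB → ℤ
slack ρ c with norm c
... | ts ≥ᵖ A = + sum (map proj₁ (filter' ts)) - A
  where
  filter' : List Term → List Term
  filter' [] = []
  filter' (u ∷ us) = if memL (~ proj₂ u) ρ then filter' us else u ∷ filter' us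

unassigned : Assignment → Lit → Set
unassigned ρ ℓ = (memL ℓ ρ ≡ false) × (memL (~ ℓ) ρ ≡ false)

-- UPConflict F ρ p : starting from ρ, unit propagation on F reaches a
-- conflict after assigning p literals.
data UPConflict (F : List PB) : Assignment → ℕ → Set where
  conflict : ∀ {ρ c} → c ∈ F → slack ρ c ℤ.< + 0 → UPConflict F ρ 0
  propagate : ∀ {ρ c p} {α : ℕ} {ℓ : Lit} → c ∈ F → (α , ℓ) ∈ lhs (norm c) →
              unassigned ρ ℓ → slack ρ c ℤ.< + α →
              UPConflict F (ℓ ∷ ρ) p → UPConflict F ρ (suc p)

-- Refutation Δ m p : from database Δ, a contradiction (a constraint with
-- negative slack under the empty assignment, e.g. 0 ≥ 1) is derived using
-- m RUP / cutting planes steps, whose RUP steps use p propagations in total.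
data Refutation (Δ : List PB) : ℕ → ℕ → Set where
  done : ∀ {c} → c ∈ Δ → slack [] c ℤ.< + 0 → Refutation Δ 0 0
  cp   : ∀ {c m p} → CPStep Δ c → Refutation (c ∷ Δ) m p → Refutation Δ (suc m) p
  rup  : ∀ {m p q} (c : PB) → UPConflict (¬ᵖ c ∷ Δ) [] q →
         Refutation (c ∷ Δ) m p → Refutation Δ (suc m) (q ℕ.+ p)

range : ℕ → List ℕ
range m = map suc (upTo m)

Slex : ℕ → (ℕ → Lit) → (ℕ → Lit) → List PB
Slex n u v =
  ((1 , ~ pos (a 1)) ∷ (1 , u 1) ∷ (1 , ~ v 1) ∷ []) ≥ᵖ (+ 1) ∷
  ((2 , pos (a 1)) ∷ (1 , ~ u 1) ∷ (1 , v 1) ∷ []) ≥ᵖ (+ 2) ∷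
  concatMap (λ i →
     ((3 , neg (a (suc i))) ∷ (2 , pos (a i)) ∷ (1 , u (suc i)) ∷ (1 , ~ v (suc i)) ∷ []) ≥ᵖ (+ 3) ∷
     ((2 , pos (a (suc i))) ∷ (2 , neg (a i)) ∷ (1 , ~ u (suc i)) ∷ (1 , v (suc i)) ∷ []) ≥ᵖ (+ 2) ∷ [])
    (range (n ℕ.∸ 2)) ++
  ((1 , neg (d 1)) ∷ (1 , v 1) ∷ (1 , ~ u 1) ∷ []) ≥ᵖ (+ 1) ∷
  ((2 , pos (d 1)) ∷ (1 , ~ v 1) ∷ (1 , u 1) ∷ []) ≥ᵖ (+ 2) ∷
  concatMap (λ i →
     ((4 , neg (d (suc i))) ∷ (3 , pos (d i)) ∷ (1 , neg (a i)) ∷ (1 , v (suc i)) ∷ (1 , ~ u (suc i)) ∷ []) ≥ᵖ (+ 4) ∷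
     ((4 , pos (d (suc i))) ∷ (3 , neg (d i)) ∷ (1 , pos (a i)) ∷ (1 , ~ v (suc i)) ∷ (1 , u (suc i)) ∷ []) ≥ᵖ (+ 3) ∷ [])
    (range (n ℕ.∸ 1))

circuit : (Lit → Lit) → (ℕ → ℕ) → ℕ → List PB
circuit σ ι k =
  ((1 , neg (s 1)) ∷ (1 , x' 1) ∷ (1 , ~ σ (x' 1)) ∷ []) ≥ᵖ (+ 1) ∷
  ((2 , pos (s 1)) ∷ (1 , ~ x' 1) ∷ (1 , σ (x' 1)) ∷ []) ≥ᵖ (+ 2) ∷
  concatMap (λ j →
     ((3 , neg (s (suc j))) ∷ (2 , pos (s j)) ∷ (1 , x' (suc j)) ∷ (1 , ~ σ (x' (suc j))) ∷ []) ≥ᵖ (+ 3) ∷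
     ((2 , pos (s (suc j))) ∷ (2 , neg (s j)) ∷ (1 , ~ x' (suc j)) ∷ (1 , σ (x' (suc j))) ∷ []) ≥ᵖ (+ 2) ∷ [])
    (range (k ℕ.∸ 2)) ++
  ((1 , neg (t 1)) ∷ (1 , σ (x' 1)) ∷ (1 , ~ x' 1) ∷ []) ≥ᵖ (+ 1) ∷
  ((2 , pos (t 1)) ∷ (1 , ~ σ (x' 1)) ∷ (1 , x' 1) ∷ []) ≥ᵖ (+ 2) ∷
  concatMap (λ j →
     ((4 , neg (t (suc j))) ∷ (3 , pos (t j)) ∷ (1 , neg (s j)) ∷ (1 , σ (x' (suc j))) ∷ (1 , ~ x' (suc j)) ∷ []) ≥ᵖ (+ 4) ∷
     ((3 , pos (t (suc j))) ∷ (3 , neg (t j)) ∷ (1 , pos (s j)) ∷ (1 , ~ σ (x' (suc j))) ∷ (1 , x' (suc j)) ∷ []) ≥ᵖ (+ 3) ∷ [])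
    (range (k ℕ.∸ 1))
  where
  x' : ℕ → Lit
  x' j = pos (x (ι j))

_≈ᵖ_ : PB → PB → Set
c ≈ᵖ c' = (lhs c ↭ lhs c') × (rhs c ≡ rhs c')

IsSymmetry : (Lit → Lit) → List PB → Set
IsSymmetry σ 𝒞 =
  (∀ ℓ → σ (~ ℓ) ≡ ~ σ ℓ) ×
  (Σ[ σ⁻¹ ∈ (Lit → Lit) ] ((∀ ℓ → σ⁻¹ (σ ℓ) ≡ ℓ) × (∀ ℓ → σ (σ⁻¹ ℓ) ≡ ℓ))) ×
  (∀ {c} → c ∈ 𝒞 → ∃[ c' ] (c' ∈ 𝒞 × (c ↾ σ) ≈ᵖ c')) ×
  (∀ {c'} → c' ∈ 𝒞 → ∃[ c ] (c ∈ 𝒞 × (c ↾ σ) ≈ᵖ c'))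

SupportIs : (Lit → Lit) → ℕ → ℕ → (ℕ → ℕ) → Set
SupportIs σ n k ι =
  (1 ℕ.≤ ι 1) ×
  (∀ j → 1 ℕ.≤ j → j ℕ.< k → ι j ℕ.< ι (suc j)) ×
  (ι k ℕ.≤ n) ×
  (∀ v → σ (pos v) ≢ pos v → ∃[ j ] (1 ℕ.≤ j × j ℕ.≤ k × v ≡ x (ι j))) ×
  (∀ j → 1 ℕ.≤ j → j ℕ.≤ k → σ (pos (x (ι j))) ≢ pos (x (ι j)))

FreshST : List PB → Set
FreshST 𝒞 = ∀ {c u} → c ∈ 𝒞 → u ∈ lhs c → isST (litVar (proj₂ u)) ≡ false

goalDB : ℕ → ℕ → (Lit → Lit) → List PB → List PB → List PB
goalDB n k σ 𝒞 𝒟 =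
  𝒞 ++ 𝒟 ++ (¬ᵖ (((1 , pos (t k)) ∷ []) ≥ᵖ (+ 1)) ∷
  Slex n (λ i → pos (x i)) (λ i → σ (pos (x i))) ++
  (((1 , pos (d n)) ∷ []) ≥ᵖ (+ 1)) ∷ [])

-- The refutation derives by RUP the clauses T_j = t_j ∨ ¬d_{ι j} (1 ≤ j ≤ k) and
-- A_j = ¬s_j ∨ a_{ι j} (1 ≤ j < k), which tie the circuit variables to the lex-specification
-- variables at the support positions, and finally ⊥ from d_n and ¬t_k.  Each check walks from
-- one support position to the next.  In between, σ fixes x_i, so the constraints of S_lex there
-- collapse to a_i → a_{i+1} and d_{i+1} → d_i, and unit propagation follows these chains at one
-- literal per position.  At the support position p itself, for T the circuit constraint on t
-- forces x_p > σ(x_p), violating the lex constraint on d, and for A the lex constraint on a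
-- forces x_p < σ(x_p), violating the circuit constraint on s.  The RUP step
-- between ι j and ι (j + 1) thus costs O(1 + ι (j + 1) − ι j) propagations, and the 2k steps
-- together cost O(n).

module Submission where

open import Defs
open import Data.Bool using (Bool; true; false; T; if_then_else_)
open import Data.Integer as ℤ using (ℤ; +_; _-_; -_)
import Data.Integer.Properties as ℤ
open import Data.List using (List; []; _∷_; _++_; map; concatMap; filter; deduplicateᵇ; length)
open import Data.List.Membership.Propositional using (_∈_)
open import Data.List.Relation.Binary.Subset.Propositional using (_⊆_)
open import Data.List.Membership.Propositional.Properties
  using (∈-++⁺ˡ; ∈-++⁺ʳ; ∈-map⁺; ∈-applyUpTo⁺; ∈-concatMap⁺)
import Data.List.Properties as List
open import Data.List.Relation.Unary.All as All using (All; []; _∷_)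
open import Data.List.Relation.Unary.All.Properties using (++⁺)
open import Data.List.Relation.Unary.AllPairs using (AllPairs; []; _∷_)
import Data.List.Relation.Unary.AllPairs.Properties as AllPairs
open import Data.List.Relation.Unary.Any as Any using (here; there)
open import Data.Nat as ℕ using (ℕ; zero; suc; _≤_; _<_; _*_; _≡ᵇ_; z≤n; s≤s)
import Data.Nat.Properties as ℕ
open import Data.Nat.ListAction using (sum)
open import Data.Nat.Tactic.RingSolver using (solve-∀)
open import Data.Product using (_×_; _,_; proj₁; proj₂; ∃-syntax)
open import Data.Sum using (_⊎_; inj₁; inj₂)
open import Function using (_∘_)
open import Relation.Nullary using (¬_; ¬?; contradiction; yes; no)
open import Relation.Nullary.Decidable using (T?; True; toWitness; map′)
open import Relation.Binary.Definitions using (DecidableEquality)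
open import Relation.Binary.PropositionalEquality

≡ᵇ-refl : ∀ n → (n ≡ᵇ n) ≡ true
≡ᵇ-refl zero    = refl
≡ᵇ-refl (suc n) = ≡ᵇ-refl n

==V-refl : ∀ v → (v ==V v) ≡ true
==V-refl (x n) = ≡ᵇ-refl n
==V-refl (a n) = ≡ᵇ-refl n
==V-refl (d n) = ≡ᵇ-refl n
==V-refl (s n) = ≡ᵇ-refl n
==V-refl (t n) = ≡ᵇ-refl n

==V⇒≡ : ∀ u v → T (u ==V v) → u ≡ v
==V⇒≡ (x m) (x n) e = cong x (ℕ.≡ᵇ⇒≡ m n e)
==V⇒≡ (a m) (a n) e = cong a (ℕ.≡ᵇ⇒≡ m n e)
==V⇒≡ (d m) (d n) e = cong d (ℕ.≡ᵇ⇒≡ m n e)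
==V⇒≡ (s m) (s n) e = cong s (ℕ.≡ᵇ⇒≡ m n e)
==V⇒≡ (t m) (t n) e = cong t (ℕ.≡ᵇ⇒≡ m n e)
==V⇒≡ (x _) (a _) ()
==V⇒≡ (x _) (d _) ()
==V⇒≡ (x _) (s _) ()
==V⇒≡ (x _) (t _) ()
==V⇒≡ (a _) (x _) ()
==V⇒≡ (a _) (d _) ()
==V⇒≡ (a _) (s _) ()
==V⇒≡ (a _) (t _) ()
==V⇒≡ (d _) (x _) ()
==V⇒≡ (d _) (a _) ()
==V⇒≡ (d _) (s _) ()
==V⇒≡ (d _) (t _) ()
==V⇒≡ (s _) (x _) ()
==V⇒≡ (s _) (a _) ()
==V⇒≡ (s _) (d _) ()
==V⇒≡ (s _) (t _) ()
==V⇒≡ (t _) (x _) ()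
==V⇒≡ (t _) (a _) ()
==V⇒≡ (t _) (d _) ()
==V⇒≡ (t _) (s _) ()

≢⇒==V-false : ∀ u v → u ≢ v → (u ==V v) ≡ false
≢⇒==V-false u v u≢v with u ==V v in eq
... | false = refl
... | true  = contradiction (==V⇒≡ u v (subst T (sym eq) _)) u≢v

_≟V_ : DecidableEquality Var
u ≟V v = map′ (==V⇒≡ u v) (λ { refl → subst T (sym (==V-refl u)) _ }) (T? (u ==V v))

_≟L_ : DecidableEquality Lit
pos u ≟L pos v = map′ (cong pos) (λ { refl → refl }) (u ≟V v)
neg u ≟L neg v = map′ (cong neg) (λ { refl → refl }) (u ≟V v)
pos _ ≟L neg _ = no λ ()
neg _ ≟L pos _ = no λ ()

==L-refl : ∀ ℓ → (ℓ ==L ℓ) ≡ true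
==L-refl (pos v) = ==V-refl v
==L-refl (neg v) = ==V-refl v

==L-false : ∀ ℓ m → litVar ℓ ≢ litVar m → (ℓ ==L m) ≡ false
==L-false (pos u) (pos v) ne = ≢⇒==V-false u v ne
==L-false (pos u) (neg v) ne = refl
==L-false (neg u) (pos v) ne = refl
==L-false (neg u) (neg v) ne = ≢⇒==V-false u v ne

~-involutive : ∀ ℓ → ~ (~ ℓ) ≡ ℓ
~-involutive (pos v) = refl
~-involutive (neg v) = refl

litVar-~ : ∀ ℓ → litVar (~ ℓ) ≡ litVar ℓ
litVar-~ (pos v) = refl
litVar-~ (neg v) = refl

x-injective : ∀ {m n} → x m ≡ x n → m ≡ n
x-injective refl = refl

a-injective : ∀ {m n} → a m ≡ a n → m ≡ n
a-injective refl = refl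

d-injective : ∀ {m n} → d m ≡ d n → m ≡ n
d-injective refl = refl

s-injective : ∀ {m n} → s m ≡ s n → m ≡ n
s-injective refl = refl

t-injective : ∀ {m n} → t m ≡ t n → m ≡ n
t-injective refl = refl

∈⇒memL : ∀ {ℓ ρ} → ℓ ∈ ρ → memL ℓ ρ ≡ true
∈⇒memL {ℓ} (here refl) rewrite ==L-refl ℓ = refl
∈⇒memL {ℓ} {m ∷ ρ} (there p) with ℓ ==L m
... | true  = refl
... | false = ∈⇒memL p

Fresh : Var → Assignment → Set
Fresh v = All (λ ℓ → litVar ℓ ≢ v)

fresh⇒memL-false : ∀ ℓ {ρ} → Fresh (litVar ℓ) ρ → memL ℓ ρ ≡ false
fresh⇒memL-false ℓ [] = refl
fresh⇒memL-false ℓ {m ∷ _} (m≢ℓ ∷ fr)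
  rewrite ==L-false ℓ m (λ e → m≢ℓ (sym e)) = fresh⇒memL-false ℓ fr

fresh⇒unassigned : ∀ ℓ {ρ} → Fresh (litVar ℓ) ρ → unassigned ρ ℓ
fresh⇒unassigned ℓ fr =
  fresh⇒memL-false ℓ fr , fresh⇒memL-false (~ ℓ) (subst (λ v → Fresh v _) (sym (litVar-~ ℓ)) fr)

-- Normal forms

var : Term → Var
var u = litVar (proj₂ u)

signedCoef : Term → ℤ
signedCoef (c , pos _) = + c
signedCoef (c , neg _) = - (+ c)

negCoef : Term → ℕ
negCoef (c , pos _) = 0
negCoef (c , neg _) = c

Distinct Positive Reduced : List Term → Set
Distinct  = AllPairs (λ u w → var u ≢ var w)
Positive  = All (λ u → 0 < proj₁ u)
Reduced ts = Distinct ts × Positive ts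

coef-absent : ∀ ts v → All (λ u → var u ≢ v) ts → coef ts v ≡ + 0
coef-absent [] v [] = refl
coef-absent ((c , pos u) ∷ ts) v (u≢v ∷ h)
  rewrite ≢⇒==V-false u v u≢v = trans (ℤ.+-identityˡ _) (coef-absent ts v h)
coef-absent ((c , neg u) ∷ ts) v (u≢v ∷ h)
  rewrite ≢⇒==V-false u v u≢v = trans (ℤ.+-identityˡ _) (coef-absent ts v h)

coef-∈ : ∀ ts {u} → Distinct ts → u ∈ ts → coef ts (var u) ≡ signedCoef u
coef-∈ ((c , pos w) ∷ ts) (h ∷ _) (here refl)
  rewrite ==V-refl w | coef-absent ts w (All.map (λ ne e → ne (sym e)) h) = ℤ.+-identityʳ _
coef-∈ ((c , neg w) ∷ ts) (h ∷ _) (here refl)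
  rewrite ==V-refl w | coef-absent ts w (All.map (λ ne e → ne (sym e)) h) = ℤ.+-identityʳ _
coef-∈ ((c , pos w) ∷ ts) {u} (h ∷ dd) (there p)
  rewrite ≢⇒==V-false w (var u) (All.lookup h p) = trans (ℤ.+-identityˡ _) (coef-∈ ts dd p)
coef-∈ ((c , neg w) ∷ ts) {u} (h ∷ dd) (there p)
  rewrite ≢⇒==V-false w (var u) (All.lookup h p) = trans (ℤ.+-identityˡ _) (coef-∈ ts dd p)

litTerm-signedCoef : ∀ u → 0 < proj₁ u → litTerm (var u) (signedCoef u) ≡ u ∷ []
litTerm-signedCoef (suc c , pos v) _ = refl
litTerm-signedCoef (suc c , neg v) _ = refl

negPart-signedCoef : ∀ u → 0 < proj₁ u → negPart (signedCoef u) ≡ negCoef u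
negPart-signedCoef (suc c , pos v) _ = refl
negPart-signedCoef (suc c , neg v) _ = refl

negSum-≡ : ∀ ts → negSum ts ≡ sum (map negCoef ts)
negSum-≡ [] = refl
negSum-≡ ((c , pos _) ∷ ts) = negSum-≡ ts
negSum-≡ ((c , neg _) ∷ ts) = cong (c ℕ.+_) (negSum-≡ ts)

deduplicate-distinct : ∀ vs → AllPairs _≢_ vs → deduplicateᵇ _==V_ vs ≡ vs
deduplicate-distinct [] [] = refl
deduplicate-distinct (v ∷ vs) (v∉ ∷ vs!) =
  cong (v ∷_) (trans (cong (filter P?) (deduplicate-distinct vs vs!))
                     (List.filter-all P? (All.map (λ {w} v≢w → ¬T (≢⇒==V-false v w v≢w)) v∉)))
  where
  P? = λ w → ¬? (T? (v ==V w))
  ¬T : ∀ {b} → b ≡ false → ¬ T b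
  ¬T refl ()

module _ (ts : List Term) where

  concatMap-litTerm : ∀ us → (∀ {u} → u ∈ us → litTerm (var u) (coef ts (var u)) ≡ u ∷ []) →
                      concatMap (λ v → litTerm v (coef ts v)) (map var us) ≡ us
  concatMap-litTerm [] f = refl
  concatMap-litTerm (u ∷ us) f rewrite f (here refl) = cong (u ∷_) (concatMap-litTerm us (λ p → f (there p)))

  sum-negPart : ∀ us → (∀ {u} → u ∈ us → negPart (coef ts (var u)) ≡ negCoef u) →
                sum (map (λ v → negPart (coef ts v)) (map var us)) ≡ sum (map negCoef us)
  sum-negPart [] f = refl
  sum-negPart (u ∷ us) f rewrite f (here refl) = cong (negCoef u ℕ.+_) (sum-negPart us (λ p → f (there p)))

norm-reduced : ∀ ts A → Reduced ts → norm (ts ≥ᵖ A) ≡ ts ≥ᵖ A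
norm-reduced ts A (distinct , positive)
  rewrite deduplicate-distinct (map var ts) (AllPairs.map⁺ distinct)
        | concatMap-litTerm ts ts (λ {u} p →
            trans (cong (litTerm (var u)) (coef-∈ ts distinct p)) (litTerm-signedCoef u (All.lookup positive p)))
        | sum-negPart ts ts (λ {u} p →
            trans (cong negPart (coef-∈ ts distinct p)) (negPart-signedCoef u (All.lookup positive p)))
        | sym (negSum-≡ ts)
        = cong (ts ≥ᵖ_) (i-j+j≡i A (+ negSum ts))
  where
  i-j+j≡i : ∀ i j → (i - j) ℤ.+ j ≡ i
  i-j+j≡i i j = begin
    (i - j) ℤ.+ j     ≡⟨ ℤ.+-assoc i (- j) j ⟩
    i ℤ.+ (- j ℤ.+ j) ≡⟨ cong (λ z → i ℤ.+ z) (ℤ.+-inverseˡ j) ⟩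
    i ℤ.+ + 0         ≡⟨ ℤ.+-identityʳ i ⟩
    i                 ∎
    where open ≡-Reasoning

-- Unit propagation

unfalsified : Assignment → List Term → List Term
unfalsified ρ [] = []
unfalsified ρ (u ∷ us) = if memL (~ proj₂ u) ρ then unfalsified ρ us else u ∷ unfalsified ρ us

-- The filter inside slack is local to Defs and unfolds only on lists of known length.
slack-≡ : ∀ ρ c ts A → norm c ≡ ts ≥ᵖ A → length ts ≤ 5 →
          slack ρ c ≡ + sum (map proj₁ (unfalsified ρ ts)) - A
slack-≡ ρ c [] A eq _ rewrite cong lhs eq | cong rhs eq = refl
slack-≡ ρ c (_ ∷ []) A eq _ rewrite cong lhs eq | cong rhs eq = refl
slack-≡ ρ c (_ ∷ _ ∷ []) A eq _ rewrite cong lhs eq | cong rhs eq = refl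
slack-≡ ρ c (_ ∷ _ ∷ _ ∷ []) A eq _ rewrite cong lhs eq | cong rhs eq = refl
slack-≡ ρ c (_ ∷ _ ∷ _ ∷ _ ∷ []) A eq _ rewrite cong lhs eq | cong rhs eq = refl
slack-≡ ρ c (_ ∷ _ ∷ _ ∷ _ ∷ _ ∷ []) A eq _ rewrite cong lhs eq | cong rhs eq = refl
slack-≡ ρ c (_ ∷ _ ∷ _ ∷ _ ∷ _ ∷ _ ∷ _) A eq (s≤s (s≤s (s≤s (s≤s (s≤s ())))))

data Weight≤ (ρ : Assignment) : List Term → ℕ → Set where
  []        : Weight≤ ρ [] 0
  falsified : ∀ {c ℓ ts b} → ~ ℓ ∈ ρ → Weight≤ ρ ts b → Weight≤ ρ ((c , ℓ) ∷ ts) b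
  counted   : ∀ {c ℓ ts b} → Weight≤ ρ ts b → Weight≤ ρ ((c , ℓ) ∷ ts) (c ℕ.+ b)

Weight≤-sound : ∀ {ρ ts b} → Weight≤ ρ ts b → sum (map proj₁ (unfalsified ρ ts)) ≤ b
Weight≤-sound [] = z≤n
Weight≤-sound (falsified ℓ̄∈ρ w) rewrite ∈⇒memL ℓ̄∈ρ = Weight≤-sound w
Weight≤-sound {ρ} (counted {c} {ℓ} {b = b} w) with memL (~ ℓ) ρ
... | true  = ℕ.≤-trans (Weight≤-sound w) (ℕ.m≤n+m b c)
... | false = ℕ.+-monoʳ-≤ c (Weight≤-sound w)

Weight≤-++ : ∀ {ρ ts us b b′} → Weight≤ ρ ts b → Weight≤ ρ us b′ → Weight≤ ρ (ts ++ us) (b ℕ.+ b′)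
Weight≤-++ [] w′ = w′
Weight≤-++ (falsified e w) w′ = falsified e (Weight≤-++ w w′)
Weight≤-++ {b′ = b′} (counted {c} {b = b} w) w′ =
  subst (Weight≤ _ _) (sym (ℕ.+-assoc c b b′)) (counted (Weight≤-++ w w′))

Weight≤-++₀ : ∀ {ρ ts us b} → Weight≤ ρ ts b → Weight≤ ρ us 0 → Weight≤ ρ (ts ++ us) b
Weight≤-++₀ w w′ = subst (Weight≤ _ _) (ℕ.+-identityʳ _) (Weight≤-++ w w′)

Weight≤-⊆ : ∀ {ρ ρ′ ts b} → ρ ⊆ ρ′ → Weight≤ ρ ts b → Weight≤ ρ′ ts b
Weight≤-⊆ ρ⊆ρ′ [] = []
Weight≤-⊆ ρ⊆ρ′ (falsified ℓ̄∈ρ w) = falsified (ρ⊆ρ′ ℓ̄∈ρ) (Weight≤-⊆ ρ⊆ρ′ w)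
Weight≤-⊆ ρ⊆ρ′ (counted w) = counted (Weight≤-⊆ ρ⊆ρ′ w)

slack≤ : ∀ {ρ c ts A b} → norm c ≡ ts ≥ᵖ A → length ts ≤ 5 → Weight≤ ρ ts b → slack ρ c ℤ.≤ + b - A
slack≤ {ρ} {c} {ts} {A} eq short w rewrite slack-≡ ρ c ts A eq short =
  ℤ.+-monoˡ-≤ (- A) (ℤ.+≤+ (Weight≤-sound w))

Conflict≤ : List PB → Assignment → ℕ → Set
Conflict≤ F ρ B = ∃[ q ] (UPConflict F ρ q × q ≤ B)

propagate≤ : ∀ {F ρ c ts A α ℓ b B} → c ∈ F → norm c ≡ ts ≥ᵖ A → (α , ℓ) ∈ ts →
             Fresh (litVar ℓ) ρ → Weight≤ ρ ts b → length ts ≤ 5 → + b - A ℤ.< + α →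
             Conflict≤ F (ℓ ∷ ρ) B → Conflict≤ F ρ (suc B)
propagate≤ {ρ = ρ} {c} {ℓ = ℓ} c∈F eq α∈ts fresh w short lt (q , up , q≤B) =
  suc q ,
  propagate c∈F (subst (λ c′ → _ ∈ lhs c′) (sym eq) α∈ts) (fresh⇒unassigned ℓ fresh)
            (ℤ.≤-<-trans (slack≤ {ρ} {c} eq short w) lt) up ,
  s≤s q≤B

conflict≤ : ∀ {F ρ c ts A b B} → c ∈ F → norm c ≡ ts ≥ᵖ A → Weight≤ ρ ts b → length ts ≤ 5 →
            + b - A ℤ.< + 0 → Conflict≤ F ρ B
conflict≤ {ρ = ρ} {c} c∈F eq w short lt = 0 , conflict c∈F (ℤ.≤-<-trans (slack≤ {ρ} {c} eq short w) lt) , z≤n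

Conflict≤-mono : ∀ {F ρ B B′} → B ≤ B′ → Conflict≤ F ρ B → Conflict≤ F ρ B′
Conflict≤-mono B≤B′ (q , up , q≤B) = q , up , ℕ.≤-trans q≤B B≤B′

≤-witness : ∀ {m n} o → m ℕ.+ o ≡ n → m ≤ n
≤-witness {m} o m+o≡n = subst (m ≤_) m+o≡n (ℕ.m≤m+n m o)

decide< : ∀ {i j} {i<j : True (i ℤ.<? j)} → i ℤ.< j
decide< {i<j = i<j} = toWitness i<j

decide≤ : ∀ {m n} {m≤n : True (m ℕ.≤? n)} → m ≤ n
decide≤ {m≤n = m≤n} = toWitness m≤n

clause₂ : Lit → Lit → PB
clause₂ ℓ₁ ℓ₂ = ((1 , ℓ₁) ∷ (1 , ℓ₂) ∷ []) ≥ᵖ (+ 1)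

norm-clause₂ : ∀ {ℓ₁ ℓ₂} → litVar ℓ₁ ≢ litVar ℓ₂ → norm (clause₂ ℓ₁ ℓ₂) ≡ clause₂ ℓ₁ ℓ₂
norm-clause₂ ℓ₁≢ℓ₂ = norm-reduced _ _ ((ℓ₁≢ℓ₂ ∷ []) ∷ [] ∷ [] , s≤s z≤n ∷ s≤s z≤n ∷ [])

RUP : List PB → PB → ℕ → Set
RUP Δ c B = Conflict≤ (¬ᵖ c ∷ Δ) [] B

rup-clause₂ : ∀ {Δ ℓ₁ ℓ₂ B} → litVar ℓ₁ ≢ litVar ℓ₂ →
              Conflict≤ (¬ᵖ (clause₂ ℓ₁ ℓ₂) ∷ Δ) (~ ℓ₂ ∷ ~ ℓ₁ ∷ []) B → RUP Δ (clause₂ ℓ₁ ℓ₂) (2 ℕ.+ B)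
rup-clause₂ {ℓ₁ = ℓ₁} {ℓ₂} ℓ₁≢ℓ₂ up =
  propagate≤ (here refl) norm-¬c (here refl) [] weight decide≤ decide<
    (propagate≤ (here refl) norm-¬c (there (here refl)) (ℓ̄₁≢ℓ̄₂ ∷ []) weight decide≤ decide< up)
  where
  ℓ̄₁≢ℓ̄₂ : litVar (~ ℓ₁) ≢ litVar (~ ℓ₂)
  ℓ̄₁≢ℓ̄₂ e = ℓ₁≢ℓ₂ (trans (sym (litVar-~ ℓ₁)) (trans e (litVar-~ ℓ₂)))
  norm-¬c : norm (¬ᵖ (clause₂ ℓ₁ ℓ₂)) ≡ ((1 , ~ ℓ₁) ∷ (1 , ~ ℓ₂) ∷ []) ≥ᵖ (+ 2)
  norm-¬c = norm-reduced _ _ ((ℓ̄₁≢ℓ̄₂ ∷ []) ∷ [] ∷ [] , s≤s z≤n ∷ s≤s z≤n ∷ [])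
  weight : ∀ {ρ} → Weight≤ ρ ((1 , ~ ℓ₁) ∷ (1 , ~ ℓ₂) ∷ []) 2
  weight = counted (counted [])

Refutes : List PB → ℕ → ℕ → Set
Refutes Δ M P = ∃[ m ] ∃[ p ] (Refutation Δ m p × m ≤ M × p ≤ P)

rup-step : ∀ {Δ c Q M P} → RUP Δ c Q → Refutes (c ∷ Δ) M P → Refutes Δ (suc M) (Q ℕ.+ P)
rup-step {c = c} (q , up , q≤Q) (m , p , R , m≤M , p≤P) =
  suc m , q ℕ.+ p , rup c up R , s≤s m≤M , ℕ.+-mono-≤ q≤Q p≤P

Refutes-mono : ∀ {Δ M M′ P P′} → M ≤ M′ → P ≤ P′ → Refutes Δ M P → Refutes Δ M′ P′
Refutes-mono M≤M′ P≤P′ (m , p , R , m≤M , p≤P) = m , p , R , ℕ.≤-trans m≤M M≤M′ , ℕ.≤-trans p≤P P≤P′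

refutes-⊥ : ∀ {Δ} → Refutes (⊥ᵖ ∷ Δ) 0 0
refutes-⊥ = 0 , 0 , done (here refl) decide< , z≤n , z≤n

isX : Var → Bool
isX (x _) = true
isX _     = false

XLits NoX : Assignment → Set
XLits = All (λ ℓ → isX (litVar ℓ) ≡ true)
NoX   = All (λ ℓ → isX (litVar ℓ) ≡ false)

isX-≢ : ∀ {u v} → isX u ≡ false → isX v ≡ true → u ≢ v
isX-≢ u∉x u∈x refl = false≢true (trans (sym u∉x) u∈x)
  where
  false≢true : false ≢ true
  false≢true ()

fresh-XLits : ∀ {v ρ} → isX v ≡ false → XLits ρ → Fresh v ρ
fresh-XLits v∉x = All.map (λ ℓ∈x e → isX-≢ v∉x ℓ∈x (sym e))

fresh-NoX : ∀ {v ρ} → isX v ≡ true → NoX ρ → Fresh v ρ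
fresh-NoX v∈x = All.map (λ ℓ∉x → isX-≢ ℓ∉x v∈x)

-- Constraints of S_lex(x, x↾σ) and of the circuit, with L standing for σ(x_p)

lexA₁ lexD₁ : Lit → PB
lexA₁ L = ((2 , pos (a 1)) ∷ (1 , neg (x 1)) ∷ (1 , L) ∷ []) ≥ᵖ (+ 2)
lexD₁ L = ((1 , neg (d 1)) ∷ (1 , L) ∷ (1 , neg (x 1)) ∷ []) ≥ᵖ (+ 1)

lexA lexD : ℕ → Lit → PB
lexA i L = ((2 , pos (a (suc i))) ∷ (2 , neg (a i)) ∷ (1 , neg (x (suc i))) ∷ (1 , L) ∷ []) ≥ᵖ (+ 2)
lexD i L =
  ((4 , neg (d (suc i))) ∷ (3 , pos (d i)) ∷ (1 , neg (a i)) ∷ (1 , L) ∷ (1 , neg (x (suc i))) ∷ []) ≥ᵖ (+ 4)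

circS₁ circT₁ : ℕ → Lit → PB
circS₁ p L = ((1 , neg (s 1)) ∷ (1 , pos (x p)) ∷ (1 , ~ L) ∷ []) ≥ᵖ (+ 1)
circT₁ p L = ((2 , pos (t 1)) ∷ (1 , ~ L) ∷ (1 , pos (x p)) ∷ []) ≥ᵖ (+ 2)

circS circT : ℕ → ℕ → Lit → PB
circS j p L = ((3 , neg (s (suc j))) ∷ (2 , pos (s j)) ∷ (1 , pos (x p)) ∷ (1 , ~ L) ∷ []) ≥ᵖ (+ 3)
circT j p L =
  ((3 , pos (t (suc j))) ∷ (3 , neg (t j)) ∷ (1 , pos (s j)) ∷ (1 , ~ L) ∷ (1 , pos (x p)) ∷ []) ≥ᵖ (+ 3)

lexA₁-aux lexD₁-aux circS₁-aux circT₁-aux : List Term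
lexA₁-aux  = (2 , pos (a 1)) ∷ []
lexD₁-aux  = (1 , neg (d 1)) ∷ []
circS₁-aux = (1 , neg (s 1)) ∷ []
circT₁-aux = (2 , pos (t 1)) ∷ []

lexA-aux lexD-aux circS-aux circT-aux : ℕ → List Term
lexA-aux i  = (2 , pos (a (suc i))) ∷ (2 , neg (a i)) ∷ []
lexD-aux i  = (4 , neg (d (suc i))) ∷ (3 , pos (d i)) ∷ (1 , neg (a i)) ∷ []
circS-aux j = (3 , neg (s (suc j))) ∷ (2 , pos (s j)) ∷ []
circT-aux j = (3 , pos (t (suc j))) ∷ (3 , neg (t j)) ∷ (1 , pos (s j)) ∷ []

suc≡ᵇ-false : ∀ i → (suc i ≡ᵇ i) ≡ false
suc≡ᵇ-false zero    = refl
suc≡ᵇ-false (suc i) = suc≡ᵇ-false i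

≡ᵇsuc-false : ∀ i → (i ≡ᵇ suc i) ≡ false
≡ᵇsuc-false zero    = refl
≡ᵇsuc-false (suc i) = ≡ᵇsuc-false i

-- Where σ fixes x_p the terms x̄_p + x_p cancel to the constant 1.

norm-lexA₁-fixed : norm (lexA₁ (pos (x 1))) ≡ lexA₁-aux ≥ᵖ (+ 1)
norm-lexA₁-fixed = refl

norm-lexA-fixed : ∀ i → norm (lexA i (pos (x (suc i)))) ≡ lexA-aux i ≥ᵖ (+ 1)
norm-lexA-fixed i rewrite suc≡ᵇ-false i | ≡ᵇsuc-false i | ≡ᵇ-refl i | suc≡ᵇ-false i = refl

norm-lexD-fixed : ∀ i → norm (lexD i (pos (x (suc i)))) ≡ lexD-aux i ≥ᵖ (+ 3)
norm-lexD-fixed i rewrite suc≡ᵇ-false i | ≡ᵇsuc-false i | ≡ᵇ-refl i | suc≡ᵇ-false i = refl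

-- Where σ flips x_p the two x_p-terms merge.

x̄₂ x₂ : ℕ → List Term
x̄₂ p = (2 , neg (x p)) ∷ []
x₂ p = (2 , pos (x p)) ∷ []

norm-lexA₁-flipped : norm (lexA₁ (neg (x 1))) ≡ (lexA₁-aux ++ x̄₂ 1) ≥ᵖ (+ 2)
norm-lexA₁-flipped = refl

norm-lexD₁-flipped : norm (lexD₁ (neg (x 1))) ≡ (lexD₁-aux ++ x̄₂ 1) ≥ᵖ (+ 1)
norm-lexD₁-flipped = refl

norm-lexA-flipped : ∀ i → norm (lexA i (neg (x (suc i)))) ≡ (lexA-aux i ++ x̄₂ (suc i)) ≥ᵖ (+ 2)
norm-lexA-flipped i rewrite suc≡ᵇ-false i | ≡ᵇsuc-false i | ≡ᵇ-refl i | suc≡ᵇ-false i = refl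

norm-lexD-flipped : ∀ i → norm (lexD i (neg (x (suc i)))) ≡ (lexD-aux i ++ x̄₂ (suc i)) ≥ᵖ (+ 4)
norm-lexD-flipped i rewrite suc≡ᵇ-false i | ≡ᵇsuc-false i | ≡ᵇ-refl i | suc≡ᵇ-false i = refl

norm-circS₁-flipped : ∀ p → norm (circS₁ p (neg (x p))) ≡ (circS₁-aux ++ x₂ p) ≥ᵖ (+ 1)
norm-circS₁-flipped p rewrite ≡ᵇ-refl p = refl

norm-circS-flipped : ∀ j p → norm (circS j p (neg (x p))) ≡ (circS-aux j ++ x₂ p) ≥ᵖ (+ 3)
norm-circS-flipped j p rewrite ≡ᵇ-refl p | ≡ᵇ-refl j | suc≡ᵇ-false j | ≡ᵇsuc-false j
                                 | ≡ᵇ-refl p | ≡ᵇ-refl j | suc≡ᵇ-false j = refl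

norm-circT₁-flipped : ∀ p → norm (circT₁ p (neg (x p))) ≡ (circT₁-aux ++ x₂ p) ≥ᵖ (+ 2)
norm-circT₁-flipped p rewrite ≡ᵇ-refl p = refl

norm-circT-flipped : ∀ j p → norm (circT j p (neg (x p))) ≡ (circT-aux j ++ x₂ p) ≥ᵖ (+ 3)
norm-circT-flipped j p rewrite ≡ᵇ-refl p | ≡ᵇ-refl j | suc≡ᵇ-false j | ≡ᵇsuc-false j
                                 | ≡ᵇ-refl p | ≡ᵇ-refl j | suc≡ᵇ-false j = refl

-- How the constraints above normalise at a position p moved by σ, with L = σ(x_p).
-- le, le′ and ge, ge′ are the normal forms of x̄_p + L and x_p + L̄ in the two term orders
-- occurring above; gtLits and ltLits assign x_p = 1, L = 0 and x_p = 0, L = 1.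
record MovedTo (p : ℕ) (L : Lit) : Set where
  field
    le le′ ge ge′ : List Term
    gtLits ltLits : Assignment
    le′-short : length le′ ≤ 2
    ge-short  : length ge ≤ 2
    ge′-short : length ge′ ≤ 2
    gtLits-x  : XLits gtLits
    le′-weight : ∀ ρ → Weight≤ ρ le′ 2
    ge-weight  : ∀ ρ → Weight≤ ρ ge 2
    ge′-weight : ∀ ρ → Weight≤ ρ ge′ 2
    le′-falsified : ∀ ρ → gtLits ⊆ ρ → Weight≤ ρ le′ 0
    ge-falsified  : ∀ ρ → ltLits ⊆ ρ → Weight≤ ρ ge 0
    norm-lexA₁  : p ≡ 1 → norm (lexA₁ L) ≡ (lexA₁-aux ++ le) ≥ᵖ (+ 2)
    norm-lexD₁  : p ≡ 1 → norm (lexD₁ L) ≡ (lexD₁-aux ++ le′) ≥ᵖ (+ 1)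
    norm-lexA   : ∀ i → p ≡ suc i → norm (lexA i L) ≡ (lexA-aux i ++ le) ≥ᵖ (+ 2)
    norm-lexD   : ∀ i → p ≡ suc i → norm (lexD i L) ≡ (lexD-aux i ++ le′) ≥ᵖ (+ 4)
    norm-circS₁ : norm (circS₁ p L) ≡ (circS₁-aux ++ ge) ≥ᵖ (+ 1)
    norm-circS  : ∀ j → norm (circS j p L) ≡ (circS-aux j ++ ge) ≥ᵖ (+ 3)
    norm-circT₁ : norm (circT₁ p L) ≡ (circT₁-aux ++ ge′) ≥ᵖ (+ 2)
    norm-circT  : ∀ j → norm (circT j p L) ≡ (circT-aux j ++ ge′) ≥ᵖ (+ 3)
    propagate-gt : ∀ {F ρ c aux A b B} → c ∈ F → norm c ≡ (aux ++ ge′) ≥ᵖ (+ A) → length aux ≤ 3 →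
                   Weight≤ ρ aux b → + (b ℕ.+ 2) - + A ℤ.< + 1 → NoX ρ →
                   Conflict≤ F (gtLits ++ ρ) B → Conflict≤ F ρ (2 ℕ.+ B)
    propagate-lt : ∀ {F ρ c aux A b B} → c ∈ F → norm c ≡ (aux ++ le) ≥ᵖ (+ A) → length aux ≤ 3 →
                   Weight≤ ρ aux b → + (b ℕ.+ 2) - + A ℤ.< + 1 → NoX ρ →
                   Conflict≤ F (ltLits ++ ρ) B → Conflict≤ F ρ (2 ℕ.+ B)

length-++≤5 : ∀ (ts us : List Term) → length ts ≤ 3 → length us ≤ 2 → length (ts ++ us) ≤ 5
length-++≤5 ts us ts≤ us≤ rewrite List.length-++ ts {us} = ℕ.+-mono-≤ ts≤ us≤

flipped : ∀ p → MovedTo p (neg (x p))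
flipped p = record
  { le = x̄₂ p ; le′ = x̄₂ p ; ge = x₂ p ; ge′ = x₂ p
  ; gtLits = pos (x p) ∷ [] ; ltLits = neg (x p) ∷ []
  ; le′-short = s≤s z≤n ; ge-short = s≤s z≤n ; ge′-short = s≤s z≤n
  ; gtLits-x = refl ∷ []
  ; le′-weight = λ _ → counted [] ; ge-weight = λ _ → counted [] ; ge′-weight = λ _ → counted []
  ; le′-falsified = λ _ gt⊆ρ → falsified (gt⊆ρ (here refl)) []
  ; ge-falsified  = λ _ lt⊆ρ → falsified (lt⊆ρ (here refl)) []
  ; norm-lexA₁ = λ { refl → norm-lexA₁-flipped }
  ; norm-lexD₁ = λ { refl → norm-lexD₁-flipped }
  ; norm-lexA  = λ { i refl → norm-lexA-flipped i }
  ; norm-lexD  = λ { i refl → norm-lexD-flipped i }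
  ; norm-circS₁ = norm-circS₁-flipped p
  ; norm-circS  = λ j → norm-circS-flipped j p
  ; norm-circT₁ = norm-circT₁-flipped p
  ; norm-circT  = λ j → norm-circT-flipped j p
  ; propagate-gt = propagate-single (pos (x p)) refl
  ; propagate-lt = propagate-single (neg (x p)) refl
  }
  where
  propagate-single : ∀ ℓ → isX (litVar ℓ) ≡ true → ∀ {F ρ c aux A b B} → c ∈ F →
                     norm c ≡ (aux ++ (2 , ℓ) ∷ []) ≥ᵖ (+ A) → length aux ≤ 3 →
                     Weight≤ ρ aux b → + (b ℕ.+ 2) - + A ℤ.< + 1 → NoX ρ →
                     Conflict≤ F (ℓ ∷ ρ) B → Conflict≤ F ρ (2 ℕ.+ B)
  propagate-single ℓ ℓ-x {aux = aux} c∈F eq short w lt noX up =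
    Conflict≤-mono (ℕ.n≤1+n _)
      (propagate≤ c∈F eq (∈-++⁺ʳ aux (here refl)) (fresh-NoX ℓ-x noX) (Weight≤-++ w (counted []))
                  (length-++≤5 aux _ short (s≤s z≤n)) (ℤ.<-trans lt decide<) up)

module _ (p q : ℕ) (q≢p : q ≢ p) (L : Lit) (L-var : litVar L ≡ x q) where
  private
    L-x : isX (litVar L) ≡ true
    L-x = cong isX L-var

    L̄-x : isX (litVar (~ L)) ≡ true
    L̄-x = trans (cong isX (litVar-~ L)) L-x

    aux≢L : ∀ {u} → isX u ≡ false → u ≢ litVar L
    aux≢L u∉x = isX-≢ u∉x L-x

    aux≢L̄ : ∀ {u} → isX u ≡ false → u ≢ litVar (~ L)
    aux≢L̄ u∉x = isX-≢ u∉x L̄-x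

    L≢xp : litVar L ≢ x p
    L≢xp e = q≢p (x-injective (trans (sym L-var) e))

    L̄≢xp : litVar (~ L) ≢ x p
    L̄≢xp e = L≢xp (trans (sym (litVar-~ L)) e)

    pos₃ : ∀ {c₁ c₂ c₃ : ℕ} {ℓ₁ ℓ₂ ℓ₃ : Lit} →
           Positive ((suc c₁ , ℓ₁) ∷ (suc c₂ , ℓ₂) ∷ (suc c₃ , ℓ₃) ∷ [])
    pos₃ = s≤s z≤n ∷ s≤s z≤n ∷ s≤s z≤n ∷ []

    le le′ ge ge′ : List Term
    le  = (1 , neg (x p)) ∷ (1 , L) ∷ []
    le′ = (1 , L) ∷ (1 , neg (x p)) ∷ []
    ge  = (1 , pos (x p)) ∷ (1 , ~ L) ∷ []
    ge′ = (1 , ~ L) ∷ (1 , pos (x p)) ∷ []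

    propagate-both : ∀ (ℓ₁ ℓ₂ : Lit) → isX (litVar ℓ₁) ≡ true → isX (litVar ℓ₂) ≡ true →
                     litVar ℓ₁ ≢ litVar ℓ₂ →
                     ∀ {F ρ c aux A b B} → c ∈ F → norm c ≡ (aux ++ (1 , ℓ₁) ∷ (1 , ℓ₂) ∷ []) ≥ᵖ (+ A) →
                     length aux ≤ 3 → Weight≤ ρ aux b → + (b ℕ.+ 2) - + A ℤ.< + 1 → NoX ρ →
                     Conflict≤ F ((ℓ₂ ∷ ℓ₁ ∷ []) ++ ρ) B → Conflict≤ F ρ (2 ℕ.+ B)
    propagate-both ℓ₁ ℓ₂ ℓ₁-x ℓ₂-x ℓ₁≢ℓ₂ {aux = aux} c∈F eq short w lt noX up =
      propagate≤ c∈F eq (∈-++⁺ʳ aux (here refl)) (fresh-NoX ℓ₁-x noX) weight length≤ lt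
        (propagate≤ c∈F eq (∈-++⁺ʳ aux (there (here refl))) ((λ e → ℓ₁≢ℓ₂ e) ∷ fresh-NoX ℓ₂-x noX)
                    (Weight≤-⊆ there weight) length≤ lt up)
      where
      weight = Weight≤-++ w (counted (counted []))
      length≤ = length-++≤5 aux _ short (s≤s (s≤s z≤n))

  moved : MovedTo p L
  moved = record
    { le = le ; le′ = le′ ; ge = ge ; ge′ = ge′
    ; gtLits = pos (x p) ∷ ~ L ∷ [] ; ltLits = L ∷ neg (x p) ∷ []
    ; le′-short = s≤s (s≤s z≤n) ; ge-short = s≤s (s≤s z≤n) ; ge′-short = s≤s (s≤s z≤n)
    ; gtLits-x = refl ∷ L̄-x ∷ []
    ; le′-weight = λ _ → counted (counted [])
    ; ge-weight  = λ _ → counted (counted [])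
    ; ge′-weight = λ _ → counted (counted [])
    ; le′-falsified = λ _ gt⊆ρ →
        falsified (gt⊆ρ (there (here refl))) (falsified (gt⊆ρ (here refl)) [])
    ; ge-falsified = λ ρ lt⊆ρ →
        falsified (lt⊆ρ (there (here refl)))
          (falsified (subst (_∈ ρ) (sym (~-involutive L)) (lt⊆ρ (here refl))) [])
    ; norm-lexA₁ = λ { refl → norm-reduced _ _
        (((λ ()) ∷ aux≢L refl ∷ []) ∷ ((λ e → L≢xp (sym e)) ∷ []) ∷ [] ∷ [] , pos₃) }
    ; norm-lexD₁ = λ { refl → norm-reduced _ _
        ((aux≢L refl ∷ (λ ()) ∷ []) ∷ (L≢xp ∷ []) ∷ [] ∷ [] , pos₃) }
    ; norm-lexA = λ { i refl → norm-reduced _ _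
        (((λ e → ℕ.1+n≢n (a-injective e)) ∷ (λ ()) ∷ aux≢L refl ∷ [])
         ∷ ((λ ()) ∷ aux≢L refl ∷ []) ∷ ((λ e → L≢xp (sym e)) ∷ []) ∷ [] ∷ []
        , s≤s z≤n ∷ pos₃) }
    ; norm-lexD = λ { i refl → norm-reduced _ _
        (((λ e → ℕ.1+n≢n (d-injective e)) ∷ (λ ()) ∷ aux≢L refl ∷ (λ ()) ∷ [])
         ∷ ((λ ()) ∷ aux≢L refl ∷ (λ ()) ∷ [])
         ∷ (aux≢L refl ∷ (λ ()) ∷ [])
         ∷ (L≢xp ∷ []) ∷ [] ∷ []
        , s≤s z≤n ∷ s≤s z≤n ∷ pos₃) }
    ; norm-circS₁ = norm-reduced _ _
        (((λ ()) ∷ aux≢L̄ refl ∷ []) ∷ ((λ e → L̄≢xp (sym e)) ∷ []) ∷ [] ∷ [] , pos₃)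
    ; norm-circS = λ j → norm-reduced _ _
        (((λ e → ℕ.1+n≢n (s-injective e)) ∷ (λ ()) ∷ aux≢L̄ refl ∷ [])
         ∷ ((λ ()) ∷ aux≢L̄ refl ∷ []) ∷ ((λ e → L̄≢xp (sym e)) ∷ []) ∷ [] ∷ []
        , s≤s z≤n ∷ pos₃)
    ; norm-circT₁ = norm-reduced _ _
        ((aux≢L̄ refl ∷ (λ ()) ∷ []) ∷ (L̄≢xp ∷ []) ∷ [] ∷ [] , pos₃)
    ; norm-circT = λ j → norm-reduced _ _
        (((λ e → ℕ.1+n≢n (t-injective e)) ∷ (λ ()) ∷ aux≢L̄ refl ∷ (λ ()) ∷ [])
         ∷ ((λ ()) ∷ aux≢L̄ refl ∷ (λ ()) ∷ [])
         ∷ (aux≢L̄ refl ∷ (λ ()) ∷ [])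
         ∷ (L̄≢xp ∷ []) ∷ [] ∷ []
        , s≤s z≤n ∷ s≤s z≤n ∷ pos₃)
    ; propagate-gt = propagate-both (~ L) (pos (x p)) L̄-x refl L̄≢xp
    ; propagate-lt = propagate-both (neg (x p)) L refl L-x (λ e → L≢xp (sym e))
    }

module _ {σ : Lit → Lit} (σ-~ : ∀ ℓ → σ (~ ℓ) ≡ ~ σ ℓ)
         (σ-injective : ∀ {ℓ m} → σ ℓ ≡ σ m → ℓ ≡ m) where

  image-moved : ∀ v → σ (pos v) ≢ pos v → σ (pos (litVar (σ (pos v)))) ≢ pos (litVar (σ (pos v)))
  image-moved v moved with σ (pos v) in σv
  ... | pos w = λ σw → moved (σ-injective (trans σw (sym σv)))
  ... | neg w = λ σw → neg≢pos (σ-injective (trans (trans (σ-~ (pos w)) (cong ~_ σw)) (sym σv)))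
    where
    neg≢pos : neg w ≢ pos v
    neg≢pos ()

litVar≡⇒≡neg : ∀ {L v} → litVar L ≡ v → L ≢ pos v → L ≡ neg v
litVar≡⇒≡neg {pos _} refl L≢v = contradiction refl L≢v
litVar≡⇒≡neg {neg _} refl _   = refl

gap : ∀ {m p} → m < p → ∃[ δ ] (p ≡ suc (δ ℕ.+ m))
gap {m} {suc p} (s≤s m≤p) = p ℕ.∸ m , cong suc (sym (ℕ.m∸n+n≡m m≤p))

module StrictlyIncreasing (ι : ℕ → ℕ) (k : ℕ) (inc : ∀ j → 1 ≤ j → j < k → ι j < ι (suc j)) where

  mono : ∀ {j m} → 1 ≤ j → j ≤ m → m ≤ k → ι j ≤ ι m
  mono {j} {zero}  1≤j j≤m _ = contradiction (ℕ.≤-trans 1≤j j≤m) λ ()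
  mono {j} {suc m} 1≤j j≤m m<k with ℕ.m≤n⇒m<n∨m≡n j≤m
  ... | inj₂ refl = ℕ.≤-refl
  ... | inj₁ j≤m′ = ℕ.≤-trans (mono 1≤j (ℕ.≤-pred j≤m′) (ℕ.<⇒≤ m<k))
                              (ℕ.<⇒≤ (inc m (ℕ.≤-trans 1≤j (ℕ.≤-pred j≤m′)) m<k))

  ≤ι : 1 ≤ ι 1 → ∀ {j} → 1 ≤ j → j ≤ k → j ≤ ι j
  ≤ι 1≤ι₁ {suc zero}    _ _   = 1≤ι₁
  ≤ι 1≤ι₁ {suc (suc j)} _ j<k =
    ℕ.≤-trans (s≤s (≤ι 1≤ι₁ (s≤s z≤n) (ℕ.<⇒≤ j<k))) (inc (suc j) (s≤s z≤n) j<k)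

-- The refutation

module CircuitRefutation (n k : ℕ) (σ : Lit → Lit) (ι : ℕ → ℕ) (𝒞 𝒟 : List PB)
         (1≤k : 1 ≤ k) (symmetry : IsSymmetry σ 𝒞) (support : SupportIs σ n k ι)
         (circuit⊆𝒟 : circuit σ ι k ⊆ 𝒟) where

  G : List PB
  G = goalDB n k σ 𝒞 𝒟

  σx : ℕ → Lit
  σx p = σ (pos (x p))

  private
    1≤ι₁ : 1 ≤ ι 1
    1≤ι₁ = proj₁ support
    ι-inc : ∀ j → 1 ≤ j → j < k → ι j < ι (suc j)
    ι-inc = proj₁ (proj₂ support)
    ιk≤n : ι k ≤ n
    ιk≤n = proj₁ (proj₂ (proj₂ support))
    moved⇒support : ∀ v → σ (pos v) ≢ pos v → ∃[ j ] (1 ≤ j × j ≤ k × v ≡ x (ι j))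
    moved⇒support = proj₁ (proj₂ (proj₂ (proj₂ support)))
    support⇒moved : ∀ j → 1 ≤ j → j ≤ k → σx (ι j) ≢ pos (x (ι j))
    support⇒moved = proj₂ (proj₂ (proj₂ (proj₂ support)))

    σ-~ : ∀ ℓ → σ (~ ℓ) ≡ ~ σ ℓ
    σ-~ = proj₁ symmetry
    σ-injective : ∀ {ℓ m} → σ ℓ ≡ σ m → ℓ ≡ m
    σ-injective {ℓ} {m} e with proj₁ (proj₂ symmetry)
    ... | σ⁻¹ , σ⁻¹∘σ , _ = trans (sym (σ⁻¹∘σ ℓ)) (trans (cong σ⁻¹ e) (σ⁻¹∘σ m))

  open StrictlyIncreasing ι k ι-inc

  ι≤n : ∀ {j} → 1 ≤ j → j ≤ k → ι j ≤ n
  ι≤n 1≤j j≤k = ℕ.≤-trans (mono 1≤j j≤k ℕ.≤-refl) ιk≤n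

  1≤ι : ∀ {j} → 1 ≤ j → j ≤ k → 1 ≤ ι j
  1≤ι 1≤j j≤k = ℕ.≤-trans 1≤j (≤ι 1≤ι₁ 1≤j j≤k)

  k≤n : k ≤ n
  k≤n = ℕ.≤-trans (≤ι 1≤ι₁ 1≤k ℕ.≤-refl) ιk≤n

  FixedBetween : ℕ → ℕ → Set
  FixedBetween lo hi = ∀ m → lo < m → m < hi → σx m ≡ pos (x m)

  fixed-gap : ∀ lo hi → (∀ j → 1 ≤ j → j ≤ k → ι j ≤ lo ⊎ hi ≤ ι j) → FixedBetween lo hi
  fixed-gap lo hi outside m lo<m m<hi with σx m ≟L pos (x m)
  ... | yes fixed = fixed
  ... | no moved with moved⇒support (x m) moved
  ... | j , 1≤j , j≤k , refl with outside j 1≤j j≤k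
  ... | inj₁ ι≤lo = contradiction ι≤lo (ℕ.<⇒≱ lo<m)
  ... | inj₂ hi≤ι = contradiction hi≤ι (ℕ.<⇒≱ m<hi)

  fixed-before : FixedBetween 0 (ι 1)
  fixed-before = fixed-gap 0 (ι 1) λ j 1≤j j≤k → inj₂ (mono (s≤s z≤n) 1≤j j≤k)

  fixed-between : ∀ j → 1 ≤ j → j < k → FixedBetween (ι j) (ι (suc j))
  fixed-between j 1≤j j<k = fixed-gap (ι j) (ι (suc j)) outside
    where
    outside : ∀ j′ → 1 ≤ j′ → j′ ≤ k → ι j′ ≤ ι j ⊎ ι (suc j) ≤ ι j′
    outside j′ 1≤j′ j′≤k with ℕ.≤-<-connex j′ j
    ... | inj₁ j′≤j = inj₁ (mono 1≤j′ j′≤j (ℕ.<⇒≤ j<k))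
    ... | inj₂ j<j′ = inj₂ (mono (s≤s z≤n) j<j′ j′≤k)

  fixed-after : FixedBetween (ι k) (suc n)
  fixed-after = fixed-gap (ι k) (suc n) λ j 1≤j j≤k → inj₁ (mono 1≤j j≤k ℕ.≤-refl)

  -- σ(x_p) is a literal over a moved, hence support, variable; over x_p itself it must be ¬x_p.
  movedAt : ∀ j → 1 ≤ j → j ≤ k → MovedTo (ι j) (σx (ι j))
  movedAt j 1≤j j≤k
    with moved⇒support (litVar (σx (ι j))) (image-moved σ-~ σ-injective (x (ι j)) (support⇒moved j 1≤j j≤k))
  ... | j′ , _ , _ , L-var with ι j′ ℕ.≟ ι j
  ... | no  q≢p  = moved (ι j) (ι j′) q≢p (σx (ι j)) L-var
  ... | yes q≡p = subst (MovedTo (ι j)) (sym (litVar≡⇒≡neg (trans L-var (cong x q≡p)) (support⇒moved j 1≤j j≤k)))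
                        (flipped (ι j))

  private
    SL : List PB
    SL = Slex n (λ i → pos (x i)) σx

    SL⊆G : SL ⊆ G
    SL⊆G c∈ = ∈-++⁺ʳ 𝒞 (∈-++⁺ʳ 𝒟 (there (∈-++⁺ˡ c∈)))

    𝒟⊆G : 𝒟 ⊆ G
    𝒟⊆G c∈ = ∈-++⁺ʳ 𝒞 (∈-++⁺ˡ c∈)

    ∈-range : ∀ {i m} → 1 ≤ i → i ≤ m → i ∈ range m
    ∈-range {suc i} (s≤s z≤n) i≤m = ∈-map⁺ suc (∈-applyUpTo⁺ (λ j → j) i≤m)

    ∈-concatMap-range : ∀ {A : Set} (f : ℕ → List A) {y i m} → y ∈ f i → 1 ≤ i → i ≤ m →
                        y ∈ concatMap f (range m)
    ∈-concatMap-range f y∈ 1≤i i≤m = ∈-concatMap⁺ f (Any.map (λ { refl → y∈ }) (∈-range 1≤i i≤m))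

    ≤∸2 : ∀ {i n} → suc (suc i) ≤ n → i ≤ n ℕ.∸ 2
    ≤∸2 {n = suc (suc n)} (s≤s (s≤s i≤n)) = i≤n

    ≤∸1 : ∀ {i n} → suc i ≤ n → i ≤ n ℕ.∸ 1
    ≤∸1 {n = suc n} (s≤s i≤n) = i≤n

    lexA-block lexD-block : ℕ → List PB
    lexA-block i =
      ((3 , neg (a (suc i))) ∷ (2 , pos (a i)) ∷ (1 , pos (x (suc i))) ∷ (1 , ~ σx (suc i)) ∷ []) ≥ᵖ (+ 3) ∷
      lexA i (σx (suc i)) ∷ []
    lexD-block i =
      lexD i (σx (suc i)) ∷
      ((4 , pos (d (suc i))) ∷ (3 , neg (d i)) ∷ (1 , pos (a i)) ∷ (1 , ~ σx (suc i)) ∷ (1 , pos (x (suc i))) ∷ [])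
        ≥ᵖ (+ 3) ∷ []

    circS-block circT-block : ℕ → List PB
    circS-block j =
      circS j (ι (suc j)) (σx (ι (suc j))) ∷
      ((2 , pos (s (suc j))) ∷ (2 , neg (s j)) ∷ (1 , neg (x (ι (suc j)))) ∷ (1 , σx (ι (suc j))) ∷ [])
        ≥ᵖ (+ 2) ∷ []
    circT-block j =
      ((4 , neg (t (suc j))) ∷ (3 , pos (t j)) ∷ (1 , neg (s j)) ∷ (1 , σx (ι (suc j))) ∷ (1 , neg (x (ι (suc j))))
        ∷ []) ≥ᵖ (+ 4) ∷
      circT j (ι (suc j)) (σx (ι (suc j))) ∷ []

  lexA₁∈G : lexA₁ (σx 1) ∈ G
  lexA₁∈G = SL⊆G (there (here refl))

  lexD₁∈G : lexD₁ (σx 1) ∈ G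
  lexD₁∈G = SL⊆G (there (there (∈-++⁺ʳ (concatMap lexA-block (range (n ℕ.∸ 2))) (here refl))))

  lexA∈G : ∀ {i} → 1 ≤ i → suc i < n → lexA i (σx (suc i)) ∈ G
  lexA∈G 1≤i i<n = SL⊆G (there (there (∈-++⁺ˡ (∈-concatMap-range lexA-block (there (here refl)) 1≤i (≤∸2 i<n)))))

  lexD∈G : ∀ {i} → 1 ≤ i → suc i ≤ n → lexD i (σx (suc i)) ∈ G
  lexD∈G 1≤i i<n = SL⊆G (there (there (∈-++⁺ʳ (concatMap lexA-block (range (n ℕ.∸ 2)))
                     (there (there (∈-concatMap-range lexD-block (here refl) 1≤i (≤∸1 i<n)))))))

  circS₁∈G : circS₁ (ι 1) (σx (ι 1)) ∈ G
  circS₁∈G = 𝒟⊆G (circuit⊆𝒟 (here refl))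

  circT₁∈G : circT₁ (ι 1) (σx (ι 1)) ∈ G
  circT₁∈G =
    𝒟⊆G (circuit⊆𝒟 (there (there (∈-++⁺ʳ (concatMap circS-block (range (k ℕ.∸ 2))) (there (here refl))))))

  circS∈G : ∀ {j} → 1 ≤ j → suc j < k → circS j (ι (suc j)) (σx (ι (suc j))) ∈ G
  circS∈G 1≤j j<k =
    𝒟⊆G (circuit⊆𝒟 (there (there (∈-++⁺ˡ (∈-concatMap-range circS-block (here refl) 1≤j (≤∸2 j<k))))))

  circT∈G : ∀ {j} → 1 ≤ j → suc j ≤ k → circT j (ι (suc j)) (σx (ι (suc j))) ∈ G
  circT∈G 1≤j j<k = 𝒟⊆G (circuit⊆𝒟 (there (there (∈-++⁺ʳ (concatMap circS-block (range (k ℕ.∸ 2)))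
                      (there (there (∈-concatMap-range circT-block (there (here refl)) 1≤j (≤∸1 j<k))))))))

  ¬C∈G : ¬ᵖ (((1 , pos (t k)) ∷ []) ≥ᵖ (+ 1)) ∈ G
  ¬C∈G = ∈-++⁺ʳ 𝒞 (∈-++⁺ʳ 𝒟 (here refl))

  dn∈G : (((1 , pos (d n)) ∷ []) ≥ᵖ (+ 1)) ∈ G
  dn∈G = ∈-++⁺ʳ 𝒞 (∈-++⁺ʳ 𝒟 (there (∈-++⁺ʳ SL (here refl))))

  aTrail : ℕ → ℕ → Assignment → Assignment
  aTrail lo zero    ρ = ρ
  aTrail lo (suc δ) ρ = pos (a (suc (δ ℕ.+ lo))) ∷ aTrail lo δ ρ

  aTrail-All : ∀ {P : Lit → Set} lo δ {ρ} → All P ρ → (∀ m → lo < m → m ≤ δ ℕ.+ lo → P (pos (a m))) →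
               All P (aTrail lo δ ρ)
  aTrail-All lo zero    Pρ Pa = Pρ
  aTrail-All lo (suc δ) Pρ Pa =
    Pa (suc (δ ℕ.+ lo)) (s≤s (ℕ.m≤n+m lo δ)) ℕ.≤-refl ∷
    aTrail-All lo δ Pρ λ m lo<m m≤ → Pa m lo<m (ℕ.m≤n⇒m≤1+n m≤)

  aTrail-⊇ : ∀ lo δ {ρ} → ρ ⊆ aTrail lo δ ρ
  aTrail-⊇ lo zero    ℓ∈ = ℓ∈
  aTrail-⊇ lo (suc δ) ℓ∈ = there (aTrail-⊇ lo δ ℓ∈)

  aTrail-last : ∀ lo δ {ρ} → pos (a lo) ∈ ρ → pos (a (δ ℕ.+ lo)) ∈ aTrail lo δ ρ
  aTrail-last lo zero    a∈ = a∈
  aTrail-last lo (suc δ) a∈ = here refl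

  dTrail : ℕ → ℕ → Assignment → Assignment
  dTrail lo zero    ρ = ρ
  dTrail lo (suc δ) ρ = dTrail lo δ (pos (d (δ ℕ.+ lo)) ∷ ρ)

  dTrail-All : ∀ {P : Lit → Set} lo δ {ρ} → All P ρ → (∀ m → lo ≤ m → m < δ ℕ.+ lo → P (pos (d m))) →
               All P (dTrail lo δ ρ)
  dTrail-All lo zero    Pρ Pd = Pρ
  dTrail-All lo (suc δ) Pρ Pd =
    dTrail-All lo δ (Pd (δ ℕ.+ lo) (ℕ.m≤n+m lo δ) ℕ.≤-refl ∷ Pρ) λ m lo≤m m< → Pd m lo≤m (ℕ.m<n⇒m<1+n m<)

  dTrail-⊇ : ∀ lo δ {ρ} → ρ ⊆ dTrail lo δ ρ
  dTrail-⊇ lo zero    ℓ∈ = ℓ∈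
  dTrail-⊇ lo (suc δ) ℓ∈ = dTrail-⊇ lo δ (there ℓ∈)

  dTrail-first : ∀ lo δ {ρ} → pos (d (δ ℕ.+ lo)) ∈ ρ → pos (d lo) ∈ dTrail lo δ ρ
  dTrail-first lo zero    d∈ = d∈
  dTrail-first lo (suc δ) d∈ = dTrail-first lo δ (here refl)

  module _ {F : List PB} (G⊆F : G ⊆ F) where

    chain-a : ∀ lo δ {ρ B} → 1 ≤ lo → δ ℕ.+ lo < n → FixedBetween lo (suc (δ ℕ.+ lo)) → pos (a lo) ∈ ρ →
              (∀ m → lo < m → m ≤ δ ℕ.+ lo → Fresh (a m) ρ) →
              Conflict≤ F (aTrail lo δ ρ) B → Conflict≤ F ρ (δ ℕ.+ B)
    chain-a lo zero _ _ _ _ _ up = up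
    chain-a lo (suc δ) {ρ} {B} 1≤lo top<n fixed a-lo∈ρ fresh up =
      subst (Conflict≤ F ρ) (ℕ.+-suc δ B)
        (chain-a lo δ 1≤lo (ℕ.<-trans (ℕ.n<1+n _) top<n) (λ m lo<m m< → fixed m lo<m (ℕ.m<n⇒m<1+n m<))
                 a-lo∈ρ (λ m lo<m m≤ → fresh m lo<m (ℕ.m≤n⇒m≤1+n m≤))
          (propagate≤ (G⊆F lexA-i∈G) (norm-lexA-fixed i) (here refl) fresh-a
                      (counted (falsified (aTrail-last lo δ a-lo∈ρ) [])) decide≤ decide< up))
      where
      i = δ ℕ.+ lo
      lexA-i∈G : lexA i (pos (x (suc i))) ∈ G
      lexA-i∈G = subst (λ L → lexA i L ∈ G) (fixed (suc i) (s≤s (ℕ.m≤n+m lo δ)) ℕ.≤-refl)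
                       (lexA∈G (ℕ.≤-trans 1≤lo (ℕ.m≤n+m lo δ)) top<n)
      fresh-a : Fresh (a (suc i)) (aTrail lo δ ρ)
      fresh-a = aTrail-All lo δ (fresh (suc i) (s≤s (ℕ.m≤n+m lo δ)) ℕ.≤-refl)
                  λ m _ m≤i e → ℕ.<⇒≢ (s≤s m≤i) (a-injective e)

    chain-d : ∀ lo δ {ρ B} → 1 ≤ lo → δ ℕ.+ lo ≤ n → FixedBetween lo (suc (δ ℕ.+ lo)) →
              pos (d (δ ℕ.+ lo)) ∈ ρ → (∀ m → lo ≤ m → m < δ ℕ.+ lo → Fresh (d m) ρ) →
              Conflict≤ F (dTrail lo δ ρ) B → Conflict≤ F ρ (δ ℕ.+ B)
    chain-d lo zero _ _ _ _ _ up = up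
    chain-d lo (suc δ) {ρ} 1≤lo top≤n fixed d-top∈ρ fresh up =
      propagate≤ (G⊆F lexD-i∈G) (norm-lexD-fixed i) (there (here refl)) (fresh i (ℕ.m≤n+m lo δ) ℕ.≤-refl)
                 (falsified d-top∈ρ (counted (counted []))) decide≤ decide<
        (chain-d lo δ 1≤lo (ℕ.<⇒≤ top≤n) (λ m lo<m m< → fixed m lo<m (ℕ.m<n⇒m<1+n m<)) (here refl)
                 (λ m lo≤m m<i → (λ e → ℕ.<⇒≢ m<i (sym (d-injective e))) ∷ fresh m lo≤m (ℕ.m<n⇒m<1+n m<i)) up)
      where
      i = δ ℕ.+ lo
      lexD-i∈G : lexD i (pos (x (suc i))) ∈ G
      lexD-i∈G = subst (λ L → lexD i L ∈ G) (fixed (suc i) (s≤s (ℕ.m≤n+m lo δ)) ℕ.≤-refl)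
                       (lexD∈G (ℕ.≤-trans 1≤lo (ℕ.m≤n+m lo δ)) top≤n)

    a-chain-to-lexD : ∀ {p} (M : MovedTo p (σx p)) lo δ {ρ} → p ≡ suc (δ ℕ.+ lo) → p ≤ n → 1 ≤ lo →
                      FixedBetween lo p → pos (a lo) ∈ ρ → (∀ m → lo < m → m ≤ δ ℕ.+ lo → Fresh (a m) ρ) →
                      pos (d p) ∈ ρ → MovedTo.gtLits M ⊆ ρ → Conflict≤ F ρ δ
    a-chain-to-lexD M lo δ {ρ} refl p≤n 1≤lo fixed a-lo∈ρ fresh d∈ρ gt⊆ρ =
      subst (Conflict≤ F ρ) (ℕ.+-identityʳ δ)
        (chain-a lo δ 1≤lo p≤n fixed a-lo∈ρ fresh
          (conflict≤ (G⊆F (lexD∈G (ℕ.≤-trans 1≤lo (ℕ.m≤n+m lo δ)) p≤n)) (norm-lexD i refl)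
            (Weight≤-++ (falsified (⊇ d∈ρ) (counted (falsified (aTrail-last lo δ a-lo∈ρ) [])))
                        (le′-falsified _ (λ ℓ∈ → ⊇ (gt⊆ρ ℓ∈))))
            (length-++≤5 (lexD-aux i) le′ decide≤ le′-short) decide<))
      where
      open MovedTo M
      i = δ ℕ.+ lo
      ⊇ = aTrail-⊇ lo δ

    a-chain-to-lexA : ∀ {p} (M : MovedTo p (σx p)) lo δ {ρ c aux A b} → p ≡ suc (δ ℕ.+ lo) → p < n → 1 ≤ lo →
                      FixedBetween lo p → pos (a lo) ∈ ρ → (∀ m → lo < m → m ≤ δ ℕ.+ lo → Fresh (a m) ρ) →
                      neg (a p) ∈ ρ → NoX ρ → c ∈ F → norm c ≡ (aux ++ MovedTo.ge M) ≥ᵖ (+ A) → length aux ≤ 3 →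
                      Weight≤ ρ aux b → + b - + A ℤ.< + 0 → Conflict≤ F ρ (δ ℕ.+ 2)
    a-chain-to-lexA M lo δ {ρ} {aux = aux} refl p<n 1≤lo fixed a-lo∈ρ fresh ā∈ρ noX c∈F norm-c short w lt =
      chain-a lo δ 1≤lo (ℕ.<-trans (ℕ.n<1+n _) p<n) fixed a-lo∈ρ fresh
        (propagate-lt (G⊆F (lexA∈G (ℕ.≤-trans 1≤lo (ℕ.m≤n+m lo δ)) p<n)) (norm-lexA i refl) decide≤
          (falsified (⊇ ā∈ρ) (falsified (aTrail-last lo δ a-lo∈ρ) [])) decide<
          (aTrail-All lo δ noX λ _ _ _ → refl)
          (conflict≤ c∈F norm-c
                     (Weight≤-++₀ (Weight≤-⊆ (λ ℓ∈ → ∈-++⁺ʳ ltLits (⊇ ℓ∈)) w) (ge-falsified _ ∈-++⁺ˡ))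
                     (length-++≤5 aux ge short ge-short) lt))
      where
      open MovedTo M
      i = δ ℕ.+ lo
      ⊇ = aTrail-⊇ lo δ

    propagate-a₁ : ∀ {ρ B} → 1 < ι 1 → Fresh (a 1) ρ → Conflict≤ F (pos (a 1) ∷ ρ) B → Conflict≤ F ρ (suc B)
    propagate-a₁ 1<ι₁ fresh =
      propagate≤ (G⊆F (subst (λ L → lexA₁ L ∈ G) (fixed-before 1 (s≤s z≤n) 1<ι₁) lexA₁∈G)) norm-lexA₁-fixed
                 (here refl) fresh (counted []) decide≤ decide<

  T-clause A-clause : ℕ → PB
  T-clause j = clause₂ (pos (t j)) (neg (d (ι j)))
  A-clause j = clause₂ (neg (s j)) (pos (a (ι j)))

  T₁-rup : ∀ {Δ} → G ⊆ Δ → RUP Δ (T-clause 1) (4 ℕ.+ ι 1)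
  T₁-rup {Δ} G⊆Δ =
    rup-clause₂ (λ ())
      (propagate-gt (there (G⊆Δ circT₁∈G)) norm-circT₁ decide≤ (falsified (there (here refl)) []) decide<
                    (refl ∷ refl ∷ []) climb)
    where
    open MovedTo (movedAt 1 ℕ.≤-refl 1≤k)
    F = ¬ᵖ (T-clause 1) ∷ Δ
    ρ = gtLits ++ pos (d (ι 1)) ∷ neg (t 1) ∷ []
    d∈ρ : pos (d (ι 1)) ∈ ρ
    d∈ρ = ∈-++⁺ʳ gtLits (here refl)
    climb : Conflict≤ F ρ (ι 1)
    climb with ℕ.m≤n⇒m<n∨m≡n 1≤ι₁
    ... | inj₂ 1≡ι₁ =
      conflict≤ (there (G⊆Δ (subst (λ p → lexD₁ (σx p) ∈ G) 1≡ι₁ lexD₁∈G))) (norm-lexD₁ (sym 1≡ι₁))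
        (Weight≤-++₀ (falsified (subst (λ p → pos (d p) ∈ ρ) (sym 1≡ι₁) d∈ρ) []) (le′-falsified _ ∈-++⁺ˡ))
        (length-++≤5 lexD₁-aux le′ decide≤ le′-short) decide<
    ... | inj₁ 1<ι₁ with gap 1<ι₁
    ... | δ , ι₁≡ =
      Conflict≤-mono (ℕ.≤-trans (s≤s (ℕ.m≤m+n δ 1)) (ℕ.≤-reflexive (sym ι₁≡)))
        (propagate-a₁ (there ∘ G⊆Δ) 1<ι₁ (++⁺ (fresh-XLits refl gtLits-x) ((λ ()) ∷ (λ ()) ∷ []))
          (a-chain-to-lexD (there ∘ G⊆Δ) (movedAt 1 ℕ.≤-refl 1≤k) 1 δ ι₁≡ (ι≤n ℕ.≤-refl 1≤k) ℕ.≤-refl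
             (λ m 1<m → fixed-before m (ℕ.<⇒≤ 1<m)) (here refl)
             (λ m 1<m _ → (λ e → ℕ.<⇒≢ 1<m (a-injective e)) ∷
                          ++⁺ (fresh-XLits refl gtLits-x) ((λ ()) ∷ (λ ()) ∷ []))
             (there d∈ρ) (λ ℓ∈ → there (∈-++⁺ˡ ℓ∈))))

  A₁-rup : ∀ {Δ} → 1 < k → G ⊆ Δ → RUP Δ (A-clause 1) (4 ℕ.+ ι 1)
  A₁-rup {Δ} 1<k G⊆Δ = rup-clause₂ (λ ()) climb
    where
    M = movedAt 1 ℕ.≤-refl 1≤k
    open MovedTo M
    F = ¬ᵖ (A-clause 1) ∷ Δ
    ρ = neg (a (ι 1)) ∷ pos (s 1) ∷ []
    circS₁-falsified : ∀ {ρ′} → pos (s 1) ∈ ρ′ → Weight≤ ρ′ circS₁-aux 0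
    circS₁-falsified s∈ = falsified s∈ []
    climb : Conflict≤ F ρ (2 ℕ.+ ι 1)
    climb with ℕ.m≤n⇒m<n∨m≡n 1≤ι₁
    ... | inj₂ 1≡ι₁ =
      propagate-lt (there (G⊆Δ (subst (λ p → lexA₁ (σx p) ∈ G) 1≡ι₁ lexA₁∈G))) (norm-lexA₁ (sym 1≡ι₁))
        decide≤
        (falsified (subst (λ p → neg (a p) ∈ ρ) (sym 1≡ι₁) (here refl)) []) decide< (refl ∷ refl ∷ [])
        (conflict≤ (there (G⊆Δ circS₁∈G)) norm-circS₁
          (Weight≤-++₀ (circS₁-falsified (∈-++⁺ʳ ltLits (there (here refl)))) (ge-falsified _ ∈-++⁺ˡ))
          (length-++≤5 circS₁-aux ge decide≤ ge-short) decide<)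
    ... | inj₁ 1<ι₁ with gap 1<ι₁
    ... | δ , ι₁≡ =
      Conflict≤-mono (ℕ.≤-trans (ℕ.≤-reflexive (cong suc (trans (ℕ.+-suc δ 1) (sym ι₁≡)))) (ℕ.n≤1+n _))
        (propagate-a₁ (there ∘ G⊆Δ) 1<ι₁ ((λ e → ℕ.<⇒≢ 1<ι₁ (sym (a-injective e))) ∷ (λ ()) ∷ [])
          (a-chain-to-lexA (there ∘ G⊆Δ) M 1 δ ι₁≡ (ℕ.<-≤-trans (ι-inc 1 ℕ.≤-refl 1<k) (ι≤n (s≤s z≤n) 1<k))
             ℕ.≤-refl (λ m 1<m → fixed-before m (ℕ.<⇒≤ 1<m)) (here refl)
             (λ m 1<m m≤ → (λ e → ℕ.<⇒≢ 1<m (a-injective e)) ∷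
                          (λ e → ℕ.<⇒≢ (subst (m <_) (sym ι₁≡) (s≤s m≤)) (sym (a-injective e))) ∷ (λ ()) ∷ [])
             (there (here refl)) (refl ∷ refl ∷ refl ∷ [])
             (there (G⊆Δ circS₁∈G)) norm-circS₁ decide≤ (circS₁-falsified (there (there (here refl)))) decide<))

  -- Unit propagation sets s_{j+1}, ¬a_p, then s_j, a_{ι j}, a up to a_{p−1}, and x_p < σ(x_p), p = ι (j + 1).
  A-rup : ∀ {Δ} j δ → 1 ≤ j → suc j < k → ι (suc j) ≡ suc (δ ℕ.+ ι j) → G ⊆ Δ → A-clause j ∈ Δ →
          RUP Δ (A-clause (suc j)) (6 ℕ.+ δ)
  A-rup {Δ} j δ 1≤j j+1<k ι≡ G⊆Δ Aj∈Δ =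
    subst (RUP Δ (A-clause (suc j))) (cong (4 ℕ.+_) (ℕ.+-comm δ 2))
      (rup-clause₂ (λ ())
        (propagate≤ (G⊆F (circS∈G 1≤j j+1<k)) (norm-circS j) (∈-++⁺ˡ {ys = ge} (there (here refl)))
           ((λ ()) ∷ (λ e → ℕ.1+n≢n (s-injective e)) ∷ [])
           (Weight≤-++ (falsified (there (here refl)) (counted [])) (ge-weight _))
           (length-++≤5 (circS-aux j) ge decide≤ ge-short) decide<
        (propagate≤ (there Aj∈Δ) (norm-clause₂ λ ()) (there (here refl))
           ((λ ()) ∷ (λ e → ℕ.<⇒≢ p₀<p (sym (a-injective e))) ∷ (λ ()) ∷ [])
           (falsified (here refl) (counted [])) decide≤ decide<
        (a-chain-to-lexA G⊆F M p₀ δ ι≡ (ℕ.<-≤-trans (ι-inc (suc j) (s≤s z≤n) j+1<k) (ι≤n (s≤s z≤n) j+1<k))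
           (1≤ι 1≤j (ℕ.<⇒≤ j<k)) (fixed-between j 1≤j j<k) (here refl)
           (λ m p₀<m m≤ → (λ e → ℕ.<⇒≢ p₀<m (a-injective e)) ∷ (λ ()) ∷
                          (λ e → ℕ.<⇒≢ (subst (m <_) (sym ι≡) (s≤s m≤)) (sym (a-injective e))) ∷ (λ ()) ∷ [])
           (there (there (here refl))) (refl ∷ refl ∷ refl ∷ refl ∷ [])
           (G⊆F (circS∈G 1≤j j+1<k)) (norm-circS j) decide≤
           (falsified (there (there (there (here refl)))) (counted [])) decide<))))
    where
    j<k = ℕ.<-trans (ℕ.n<1+n j) j+1<k
    M = movedAt (suc j) (s≤s z≤n) (ℕ.<⇒≤ j+1<k)
    open MovedTo M
    p₀ = ι j
    p₀<p : p₀ < ι (suc j)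
    p₀<p = ι-inc j 1≤j j<k
    G⊆F : G ⊆ (¬ᵖ (A-clause (suc j)) ∷ Δ)
    G⊆F = there ∘ G⊆Δ

  -- Unit propagation sets ¬t_{j+1}, d_p, then d down to d_{ι j}, t_j, x_p > σ(x_p), s_j, a_{ι j},
  -- and a up to a_{p−1}, where p = ι (j + 1).
  T-rup : ∀ {Δ} j δ → 1 ≤ j → suc j ≤ k → ι (suc j) ≡ suc (δ ℕ.+ ι j) → G ⊆ Δ → T-clause j ∈ Δ →
          A-clause j ∈ Δ → RUP Δ (T-clause (suc j)) (8 ℕ.+ (δ ℕ.+ δ))
  T-rup {Δ} j δ 1≤j j<k ι≡ G⊆Δ Tj∈Δ Aj∈Δ =
    subst (RUP Δ (T-clause (suc j))) (cost δ)
      (rup-clause₂ (λ ())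
        (propagate≤ (G⊆F lexD-i∈G) (norm-lexD i ι≡) (∈-++⁺ˡ {ys = le′} (there (here refl)))
           ((λ e → ℕ.1+n≢n (trans (sym ι≡) (d-injective e))) ∷ (λ ()) ∷ [])
           (Weight≤-++ (falsified (subst (λ p → pos (d p) ∈ ρ₀) ι≡ (here refl)) (counted (counted [])))
                       (le′-weight _))
           (length-++≤5 (lexD-aux i) le′ decide≤ le′-short) decide<
        (chain-d G⊆F p₀ δ 1≤p₀ (ℕ.<⇒≤ (subst (_≤ n) ι≡ p≤n))
           (subst (FixedBetween p₀) ι≡ (fixed-between j 1≤j j<k))
           (here refl)
           (λ m p₀≤m m<i → (λ e → ℕ.<⇒≢ m<i (sym (d-injective e))) ∷
                           (λ e → ℕ.<⇒≢ (ℕ.<-trans m<i (subst (i <_) (sym ι≡) (ℕ.n<1+n i))) (sym (d-injective e))) ∷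
                           (λ ()) ∷ [])
        (propagate≤ (there Tj∈Δ) (norm-clause₂ λ ()) (here refl)
           (dTrail-All p₀ δ ((λ ()) ∷ (λ ()) ∷ (λ e → ℕ.1+n≢n (t-injective e)) ∷ []) λ _ _ _ ())
           (counted (falsified (dTrail-first p₀ δ (here refl)) [])) decide≤ decide<
        (propagate-gt (G⊆F (circT∈G 1≤j j<k)) (norm-circT j) decide≤
           (falsified (there (⊇ t̄∈ρ₁)) (falsified (here refl) (counted []))) decide<
           (refl ∷ dTrail-All p₀ δ (refl ∷ refl ∷ refl ∷ []) λ _ _ _ → refl)
        (propagate≤ (G⊆F (circT∈G 1≤j j<k)) (norm-circT j) (∈-++⁺ˡ {ys = ge′} (there (there (here refl))))
           (fresh-ρ₄ refl (λ _ ()) (λ _ ()))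
           (Weight≤-++ (falsified (∈-++⁺ʳ gtLits (there (⊇ t̄∈ρ₁)))
                          (falsified (∈-++⁺ʳ gtLits (here refl)) (counted [])))
                       (ge′-weight _))
           (length-++≤5 (circT-aux j) ge′ decide≤ ge′-short) decide<
        (propagate≤ (there Aj∈Δ) (norm-clause₂ λ ()) (there (here refl))
           ((λ ()) ∷ fresh-ρ₄ refl (λ _ ()) (λ _ ()))
           (falsified (here refl) (counted [])) decide≤ decide<
        (a-chain-to-lexD G⊆F M p₀ δ ι≡ p≤n 1≤p₀ (fixed-between j 1≤j j<k) (here refl)
           (λ m p₀<m _ → (λ e → ℕ.<⇒≢ p₀<m (a-injective e)) ∷ (λ ()) ∷ fresh-ρ₄ refl (λ _ ()) (λ _ ()))
           (there (there (∈-++⁺ʳ gtLits (there (⊇ (there (here refl)))))))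
           (λ ℓ∈ → there (there (∈-++⁺ˡ ℓ∈)))))))))))
    where
    cost : ∀ δ → 2 ℕ.+ suc (δ ℕ.+ suc (2 ℕ.+ suc (suc δ))) ≡ 8 ℕ.+ (δ ℕ.+ δ)
    cost = solve-∀
    M = movedAt (suc j) (s≤s z≤n) j<k
    open MovedTo M
    p₀ = ι j
    i = δ ℕ.+ p₀
    1≤p₀ : 1 ≤ p₀
    1≤p₀ = 1≤ι 1≤j (ℕ.<⇒≤ j<k)
    p≤n : ι (suc j) ≤ n
    p≤n = ι≤n (s≤s z≤n) j<k
    G⊆F : G ⊆ (¬ᵖ (T-clause (suc j)) ∷ Δ)
    G⊆F = there ∘ G⊆Δ
    lexD-i∈G : lexD i (σx (ι (suc j))) ∈ G
    lexD-i∈G = subst (λ p → lexD i (σx p) ∈ G) (sym ι≡)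
                     (lexD∈G (ℕ.≤-trans 1≤p₀ (ℕ.m≤n+m p₀ δ)) (subst (_≤ n) ι≡ p≤n))
    ρ₀ ρ₁ : Assignment
    ρ₀ = pos (d (ι (suc j))) ∷ neg (t (suc j)) ∷ []
    ρ₁ = pos (d i) ∷ ρ₀
    ⊇ = dTrail-⊇ p₀ δ {ρ₁}
    t̄∈ρ₁ : neg (t (suc j)) ∈ ρ₁
    t̄∈ρ₁ = there (there (here refl))
    fresh-ρ₄ : ∀ {v} → isX v ≡ false → (∀ m → d m ≢ v) → (∀ m → t m ≢ v) →
               Fresh v (gtLits ++ pos (t j) ∷ dTrail p₀ δ ρ₁)
    fresh-ρ₄ v∉x d≢v t≢v =
      ++⁺ (fresh-XLits v∉x gtLits-x)
          (t≢v j ∷ dTrail-All p₀ δ (d≢v i ∷ d≢v (ι (suc j)) ∷ t≢v (suc j) ∷ []) λ m _ _ → d≢v m)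

  ⊥-rup : ∀ {Δ} δ → n ≡ δ ℕ.+ ι k → G ⊆ Δ → T-clause k ∈ Δ → RUP Δ ⊥ᵖ (2 ℕ.+ δ)
  ⊥-rup {Δ} δ n≡ G⊆Δ Tk∈Δ =
    subst (λ B → RUP Δ ⊥ᵖ (2 ℕ.+ B)) (ℕ.+-identityʳ δ)
      (propagate≤ (G⊆F dn∈G) (norm-reduced _ (+ 1) ([] ∷ [] , s≤s z≤n ∷ [])) (here refl) [] (counted [])
                  decide≤ decide<
      (propagate≤ (G⊆F ¬C∈G) (norm-reduced ((1 , neg (t k)) ∷ []) (+ 1) ([] ∷ [] , s≤s z≤n ∷ [])) (here refl)
                  ((λ ()) ∷ [])
                  (counted []) decide≤ decide<
      (chain-d G⊆F (ι k) δ (1≤ι 1≤k ℕ.≤-refl) (ℕ.≤-reflexive (sym n≡))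
               (subst (λ m → FixedBetween (ι k) (suc m)) n≡ fixed-after)
               dn∈ρ
               (λ m _ m< → (λ ()) ∷ (λ e → ℕ.<⇒≢ m< (trans (sym (d-injective e)) n≡)) ∷ [])
      (conflict≤ (there Tk∈Δ) (norm-clause₂ λ ())
                 (falsified (dTrail-⊇ (ι k) δ (here refl)) (falsified (dTrail-first (ι k) δ dn∈ρ) []))
                 decide≤ decide<))))
    where
    G⊆F : G ⊆ (¬ᵖ ⊥ᵖ ∷ Δ)
    G⊆F = there ∘ G⊆Δ
    dn∈ρ : pos (d (δ ℕ.+ ι k)) ∈ neg (t k) ∷ pos (d n) ∷ []
    dn∈ρ = subst (λ m → pos (d m) ∈ neg (t k) ∷ pos (d n) ∷ []) n≡ (there (here refl))

  -- Propagations needed from T_j on, where r = k − j and g = n − ι j: the RUP steps for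
  -- T_{j+1} and A_{j+1} together cost 14 + 3δ when ι (j + 1) = ι j + δ + 1.
  Cost : ℕ → ℕ → ℕ
  Cost r g = 15 * r ℕ.+ 3 * g ℕ.+ 2

  remaining-distance : ∀ {p p′ g g′ δ} → p ℕ.+ g ≡ n → p′ ℕ.+ g′ ≡ n → p′ ≡ suc (δ ℕ.+ p) →
                       g ≡ suc (δ ℕ.+ g′)
  remaining-distance {p} {p′} {g} {g′} {δ} p+g≡n p′+g′≡n p′≡ = ℕ.+-cancelˡ-≡ p g (suc (δ ℕ.+ g′)) (begin
    p ℕ.+ g                    ≡⟨ trans p+g≡n (sym p′+g′≡n) ⟩
    p′ ℕ.+ g′                  ≡⟨ cong (ℕ._+ g′) p′≡ ⟩
    suc (δ ℕ.+ p) ℕ.+ g′       ≡⟨ shift δ p g′ ⟩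
    p ℕ.+ suc (δ ℕ.+ g′)       ∎)
    where
    open ≡-Reasoning
    shift : ∀ δ p g′ → suc (δ ℕ.+ p) ℕ.+ g′ ≡ p ℕ.+ suc (δ ℕ.+ g′)
    shift = solve-∀

  refute-from : ∀ r j g {Δ} → r ℕ.+ j ≡ k → 1 ≤ j → ι j ℕ.+ g ≡ n → G ⊆ Δ → T-clause j ∈ Δ →
                (0 < r → A-clause j ∈ Δ) → Refutes Δ (suc (2 * r)) (Cost r g)
  refute-from zero j g {Δ} j≡k _ ι+g≡n G⊆Δ T∈Δ _ =
    Refutes-mono ℕ.≤-refl (≤-witness (g ℕ.+ g) (bound g))
      (rup-step (⊥-rup g n≡ G⊆Δ (subst (λ j → T-clause j ∈ Δ) j≡k T∈Δ)) refutes-⊥)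
    where
    n≡ : n ≡ g ℕ.+ ι k
    n≡ = trans (sym ι+g≡n) (trans (ℕ.+-comm (ι j) g) (cong (λ j → g ℕ.+ ι j) j≡k))
    bound : ∀ g → 2 ℕ.+ g ℕ.+ 0 ℕ.+ (g ℕ.+ g) ≡ 15 * 0 ℕ.+ 3 * g ℕ.+ 2
    bound = solve-∀
  refute-from (suc r) j g {Δ} r+j≡k 1≤j ι+g≡n G⊆Δ T∈Δ A∈Δ =
    advance (gap (ι-inc j 1≤j j+1≤k)) (ℕ.m≤n⇒∃[o]m+o≡n (ι≤n (s≤s z≤n) j+1≤k))
    where
    j+1≤k : suc j ≤ k
    j+1≤k = subst (suc j ≤_) r+j≡k (s≤s (ℕ.m≤n+m j r))
    advance : ∃[ δ ] (ι (suc j) ≡ suc (δ ℕ.+ ι j)) → ∃[ g′ ] (ι (suc j) ℕ.+ g′ ≡ n) →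
              Refutes Δ (suc (2 * suc r)) (Cost (suc r) g)
    advance (δ , ι≡) (g′ , ι′+g′≡n) =
      Refutes-mono (ℕ.≤-reflexive (steps r)) (≤-witness 4 (subst (λ g → _ ≡ Cost (suc r) g) (sym g≡) (cost δ g′ r)))
        (rup-step (T-rup j δ 1≤j j+1≤k ι≡ G⊆Δ T∈Δ (A∈Δ (s≤s z≤n))) (continue r r+j≡k))
      where
      g≡ : g ≡ suc (δ ℕ.+ g′)
      g≡ = remaining-distance ι+g≡n ι′+g′≡n ι≡
      steps : ∀ r → suc (suc (suc (2 * r))) ≡ suc (2 * suc r)
      steps = solve-∀
      cost : ∀ δ g′ r → 8 ℕ.+ (δ ℕ.+ δ) ℕ.+ (6 ℕ.+ δ ℕ.+ (15 * r ℕ.+ 3 * g′ ℕ.+ 2)) ℕ.+ 4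
                         ≡ 15 * suc r ℕ.+ 3 * suc (δ ℕ.+ g′) ℕ.+ 2
      cost = solve-∀
      continue : ∀ r → suc r ℕ.+ j ≡ k →
                 Refutes (T-clause (suc j) ∷ Δ) (suc (suc (2 * r))) (6 ℕ.+ δ ℕ.+ Cost r g′)
      continue zero j+1≡k =
        Refutes-mono (ℕ.n≤1+n _) (ℕ.m≤n+m _ (6 ℕ.+ δ))
          (refute-from zero (suc j) g′ j+1≡k (s≤s z≤n) ι′+g′≡n (there ∘ G⊆Δ) (here refl) λ ())
      continue (suc r) r+j≡k =
        rup-step (A-rup j δ 1≤j (subst (suc (suc j) ≤_) r+j≡k (s≤s (s≤s (ℕ.m≤n+m j r)))) ι≡ (there ∘ G⊆Δ)
                        (there (A∈Δ (s≤s z≤n))))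
          (refute-from (suc r) (suc j) g′ (trans (cong suc (ℕ.+-suc r j)) r+j≡k) (s≤s z≤n) ι′+g′≡n
                       (there ∘ there ∘ G⊆Δ) (there (here refl)) λ _ → here refl)

  refutation : Refutes G (18 * k) (18 * n)
  refutation with ℕ.m≤n⇒∃[o]m+o≡n 1≤k | ℕ.m≤n⇒∃[o]m+o≡n (ι≤n ℕ.≤-refl 1≤k)
  ... | r , 1+r≡k | g , ι₁+g≡n =
    Refutes-mono (≤-witness (15 ℕ.+ 16 * r) (subst (λ k → _ ≡ 18 * k) 1+r≡k (steps r)))
                 (ℕ.≤-trans (≤-witness (ι 1 ℕ.+ 5) (cost (ι 1) g r)) bound)
      (rup-step (T₁-rup (λ c∈ → c∈)) (continue r 1+r≡k))
    where
    continue : ∀ r → suc r ≡ k → Refutes (T-clause 1 ∷ G) (suc (suc (2 * r))) (4 ℕ.+ ι 1 ℕ.+ Cost r g)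
    continue zero 1≡k =
      Refutes-mono (ℕ.n≤1+n _) (ℕ.m≤n+m _ (4 ℕ.+ ι 1))
        (refute-from zero 1 g 1≡k ℕ.≤-refl ι₁+g≡n there (here refl) λ ())
    continue (suc r) 2+r≡k =
      rup-step (A₁-rup (subst (1 <_) 2+r≡k (s≤s (s≤s z≤n))) there)
        (refute-from (suc r) 1 g (trans (ℕ.+-comm (suc r) 1) 2+r≡k) ℕ.≤-refl ι₁+g≡n (there ∘ there)
                     (there (here refl)) λ _ → here refl)
    steps : ∀ r → suc (suc (suc (2 * r))) ℕ.+ (15 ℕ.+ 16 * r) ≡ 18 * suc r
    steps = solve-∀
    cost : ∀ ι₁ g r → 4 ℕ.+ ι₁ ℕ.+ (4 ℕ.+ ι₁ ℕ.+ (15 * r ℕ.+ 3 * g ℕ.+ 2)) ℕ.+ (ι₁ ℕ.+ 5)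
                      ≡ 15 * suc r ℕ.+ 3 * (ι₁ ℕ.+ g)
    cost = solve-∀
    bound : 15 * suc r ℕ.+ 3 * (ι 1 ℕ.+ g) ≤ 18 * n
    bound = begin
      15 * suc r ℕ.+ 3 * (ι 1 ℕ.+ g) ≡⟨ cong₂ (λ k m → 15 * k ℕ.+ 3 * m) 1+r≡k ι₁+g≡n ⟩
      15 * k ℕ.+ 3 * n               ≤⟨ ℕ.+-monoˡ-≤ (3 * n) (ℕ.*-monoʳ-≤ 15 k≤n) ⟩
      15 * n ℕ.+ 3 * n               ≡⟨ sym (ℕ.*-distribʳ-+ n 15 3) ⟩
      18 * n                         ∎
      where open ℕ.≤-Reasoning

lemma16 : ∃[ c₀ ] (∀ (n k : ℕ) (σ : Lit → Lit) (ι : ℕ → ℕ) (𝒞 𝒟 : List PB) →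
            1 ≤ k → IsSymmetry σ 𝒞 → SupportIs σ n k ι → FreshST 𝒞 →
            (∀ {c} → c ∈ circuit σ ι k → c ∈ 𝒟) →
            ∃[ m ] ∃[ p ] (Refutation (goalDB n k σ 𝒞 𝒟) m p × m ≤ c₀ * k × p ≤ c₀ * n))
lemma16 = 18 , λ n k σ ι 𝒞 𝒟 1≤k symmetry support _ circuit⊆𝒟 →
  CircuitRefutation.refutation n k σ ι 𝒞 𝒟 1≤k symmetry support circuit⊆𝒟
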